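{- Let $\mathbf{k}=(k_1,\ldots,k_r)$ be a non-empty index (tuple of positive integers, $r\ge 1$) and $N$ a positive integer. Then \[G_{(k_r,\ldots,k_1)}(N-1)=\zeta^{\star\flat}_{<N}(\mathbf{k}),\] where $\zeta^{\star\flat}_{<N}(\mathbf{k})=\sum\prod_{i=1}^r\frac{1}{(N-n_{i1})n_{i2}\cdots n_{ik_i}}$, the sum running over all integers $n_{ij}$ ($1\le i\le r$, $1\le j\le k_i$) with $0<n_{i1}\le\cdots\le n_{ik_i}<N$ for each $i$ and $n_{(i-1)1}\le n_{ik_i}$ for $2\le i\le r$.
   Context: For a non-empty index $\mathbf{l}=(l_1,\ldots,l_s)$ and complex $z$ with $\operatorname{Re}(z)>-1$, \[G_{\mathbf{l}}(z)=\sum\ \prod_{i=1}^{s-1}\frac{1}{(m_{i1}+z)\cdots(m_{i(l_i-1)}+z)\,m_{il_i}}\cdot\frac{1}{(m_{s1}+z)\cdots(m_{s(l_s-1)}+z)}\Bigl(\frac{1}{m_{sl_s}}-\frac{1}{m_{sl_s}+z}\Bigr),\] an infinite series over all positive integers $m_{ij}$ ($1\le i\le s$, $1\le j\le l_i$) satisfying $0<m_{11}\le\cdots\le m_{1l_1}<m_{21}\le\cdots\le m_{2l_2}<\cdots<m_{s1}\le\cdots\le m_{sl_s}$ (i.e. weak inequalities within each block, strict inequality $m_{il_i}<m_{(i+1)1}$ between consecutive blocks). -}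

module Defs where

open import Data.Nat as ℕ using (ℕ; zero; suc; _∸_; _≤?_)
import Data.Nat
open import Data.Integer using (+_)
open import Data.Rational using (ℚ; _/_; 0ℚ; 1ℚ; _+_; _*_; _-_; ∣_∣; _<_)
open import Data.List using (List; []; _∷_; [_]; map; concatMap; applyUpTo; filter; foldr)
open import Data.Product using (∃)

-- 1/n as a rational; the value at n = 0 is a dummy (never used below,
-- since every argument of inv occurring in the sums is ≥ 1).
inv : ℕ → ℚ
inv zero    = 0ℚ
inv (suc n) = + 1 / suc n

sumℚ : List ℚ → ℚ
sumℚ = foldr _+_ 0ℚ

prodℚ : List ℚ → ℚ
prodℚ = foldr _*_ 1ℚ

range : ℕ → ℕ → List ℕ
range lo hi = applyUpTo (lo ℕ.+_) (suc hi ∸ lo)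

wchains : ℕ → ℕ → ℕ → List (List ℕ)
wchains zero    lo hi = [ [] ]
wchains (suc l) lo hi = concatMap (λ m → map (m ∷_) (wchains l m hi)) (range lo hi)

lastOr : ℕ → List ℕ → ℕ
lastOr d []       = d
lastOr d (x ∷ xs) = lastOr x xs

headOr : ℕ → List ℕ → ℕ
headOr d []      = d
headOr d (x ∷ _) = x

-- blocks (m_{i1} ≤ … ≤ m_{il_i}) with m_{11} ≥ lo, strict between blocks,
-- all entries ≤ M
gBlocks : List ℕ → ℕ → ℕ → List (List (List ℕ))
gBlocks []       lo M = [ [] ]
gBlocks (l ∷ ls) lo M =
  concatMap (λ b → map (b ∷_) (gBlocks ls (suc (lastOr lo b)) M)) (wchains l lo M)

-- factor of a non-final block: 1/((m₁+z)⋯(m_{l-1}+z) m_l)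
midBlock : ℕ → List ℕ → ℚ
midBlock z []           = 1ℚ
midBlock z (m ∷ [])     = inv m
midBlock z (m ∷ m' ∷ ms) = inv (m ℕ.+ z) * midBlock z (m' ∷ ms)

-- factor of the final block: 1/((m₁+z)⋯(m_{l-1}+z)) (1/m_l − 1/(m_l+z))
lastBlock : ℕ → List ℕ → ℚ
lastBlock z []            = 1ℚ
lastBlock z (m ∷ [])      = inv m - inv (m ℕ.+ z)
lastBlock z (m ∷ m' ∷ ms) = inv (m ℕ.+ z) * lastBlock z (m' ∷ ms)

gTerm : ℕ → List (List ℕ) → ℚ
gTerm z []            = 1ℚ
gTerm z (b ∷ [])      = lastBlock z b
gTerm z (b ∷ b' ∷ bs) = midBlock z b * gTerm z (b' ∷ bs)

-- partial sum of G_l(z) over all admissible m_ij with m_ij ≤ M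
Gpartial : ℕ → List ℕ → ℕ → ℚ
Gpartial z l M = sumℚ (map (gTerm z) (gBlocks l 1 M))

zBlock : ℕ → List ℕ → ℚ
zBlock N []       = 1ℚ
zBlock N (n ∷ ns) = inv (N ∸ n) * prodℚ (map inv ns)

-- sum over blocks 0 < n_{i1} ≤ … ≤ n_{ik_i} < N with bound ≤ n_{ik_i},
-- where bound is n_{(i-1)1} of the previous block (0 for the first block)
zsum : ℕ → List ℕ → ℕ → ℚ
zsum N []       bound = 1ℚ
zsum N (k ∷ ks) bound =
  sumℚ (map (λ b → zBlock N b * zsum N ks (headOr 0 b))
            (filter (λ b → bound ≤? lastOr 0 b) (wchains k 1 (N ∸ 1))))

zetaStarFlat< : ℕ → List ℕ → ℚ
zetaStarFlat< N k = zsum N k 0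

ConvergesTo : (ℕ → ℚ) → ℚ → Set
ConvergesTo f q = ∀ (ε : ℚ) → 0ℚ < ε →
  ∃ λ M₀ → ∀ M → M₀ Data.Nat.≤ M → ∣ f M - q ∣ < ε

-- Put N = z + 1 and view maps ℕ → ℚ as vectors indexed by 1, …, z. Four operators act on them:
-- prefix sums, suffix sums, and division of the n-th entry by n or by N − n. Summing the chains
-- of ζ^{⋆♭}_{<N}(k) one block at a time writes it as ⟨1, ⟦W⟧ 1⟩ for a word W in these operators.
-- The tail of G_{(k_r,…,k_1)}(N − 1) over m₁₁ ≥ m is Φ c m = ∑ₙ c n / (m + n − 1) for the image c
-- of 1 under a second word, because Φ obeys the same one-step recursions in m as the nested
-- tails of G; so the limit is ⟨1, ⟦W′⟧ 1⟩ with W′ the reverse of W with the two divisions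
-- exchanged. Transposition (which reverses words) composed with the reflection n ↦ N − n
-- (which exchanges prefix with suffix and the two divisions) shows ⟨1, ⟦W⟧ 1⟩ = ⟨1, ⟦W′⟧ 1⟩.
-- Truncating all m_ij at M loses, level by level, the tail beyond M (at most K / (M + 1)) plus
-- the inner error weighted by harmonic numbers, so the error is K (1 + H_M)^(k₁+⋯+k_r) / (M + 1) → 0.

module Submission where

open import Defs
open import Data.Nat using (ℕ; _≤_; _∸_)
open import Data.List using (List; []; reverse)
open import Data.List.Relation.Unary.All using (All)
open import Relation.Binary.PropositionalEquality using (_≢_)

open import Data.Nat using (zero; suc; z≤n; s≤s; _<_; _≤?_) renaming (_+_ to _+ₙ_; _*_ to _*ₙ_)
import Data.Nat.Properties as ℕP
open import Data.Nat.ListAction using (sum)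
import Data.Integer as ℤ
import Data.Integer.Properties as ZP
open import Data.Rational using (ℚ; mkℚ; 0ℚ; 1ℚ; _+_; _*_; _-_; -_; ∣_∣; toℚᵘ; positive; nonNegative) renaming (_≤_ to _≤ℚ_; _<_ to _<ℚ_)
import Data.Rational.Properties as ℚP
import Data.Rational.Unnormalised as ℚᵘ
import Data.Rational.Unnormalised.Properties as ℚᵘP
open import Data.Rational.Solver using (module +-*-Solver)
open +-*-Solver using (solve; con; _:+_; _:*_; _:-_; :-_; _:=_)
open import Algebra.Bundles using (CommutativeRing)
open import Algebra.Properties.Semiring.Exp (CommutativeRing.semiring ℚP.+-*-commutativeRing) using (_^_; ^-homo-*)
open import Data.List using (_∷_; [_]; map; concatMap; applyUpTo; filter; _++_)
import Data.List.Properties as ListP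
open import Data.List.Membership.Propositional using (_∈_)
open import Data.List.Membership.Propositional.Properties using (∈-applyUpTo⁻)
open import Data.List.Relation.Unary.Any using (here; there)
open import Data.List.Relation.Unary.All as All using (_∷_)
import Data.List.Relation.Unary.All.Properties as AllP
open import Data.Bool using (Bool; true; false; if_then_else_)
open import Data.Empty using (⊥-elim)
open import Relation.Nullary using (Dec; yes; no; does; ¬_)
open import Relation.Nullary.Decidable using (dec-true; dec-false)
open import Relation.Binary.PropositionalEquality using (_≡_; refl; sym; trans; cong; cong₂; subst; module ≡-Reasoning)
open import Data.Product using (_×_; _,_; proj₁; proj₂; ∃; ∃₂)
open import Data.Sum using (inj₁; inj₂)
open import Function using (_∘_; id)

fromℕ : ℕ → ℚ
fromℕ zero    = 0ℚ
fromℕ (suc n) = 1ℚ + fromℕ n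

toℚᵘ-fromℕ : ∀ n → toℚᵘ (fromℕ n) ℚᵘ.≃ ℚᵘ.mkℚᵘ (ℤ.+ n) 0
toℚᵘ-fromℕ zero    = ℚᵘ.*≡* refl
toℚᵘ-fromℕ (suc n) = ℚᵘP.≃-trans (ℚP.toℚᵘ-homo-+ 1ℚ (fromℕ n))
  (ℚᵘP.≃-trans (ℚᵘP.+-congʳ (ℚᵘ.mkℚᵘ (ℤ.+ 1) 0) (toℚᵘ-fromℕ n))
    (ℚᵘ.*≡* (trans (ZP.*-identityʳ _) (trans (cong (ℤ._+_ (ℤ.+ 1)) (ZP.*-identityʳ (ℤ.+ n))) (sym (ZP.*-identityʳ (ℤ.+ suc n)))))))

fromℕ-+ : ∀ m n → fromℕ (m +ₙ n) ≡ fromℕ m + fromℕ n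
fromℕ-+ zero    n = sym (ℚP.+-identityˡ (fromℕ n))
fromℕ-+ (suc m) n = trans (cong (1ℚ +_) (fromℕ-+ m n)) (sym (ℚP.+-assoc 1ℚ (fromℕ m) (fromℕ n)))

fromℕ-* : ∀ m n → fromℕ (m *ₙ n) ≡ fromℕ m * fromℕ n
fromℕ-* zero    n = sym (ℚP.*-zeroˡ (fromℕ n))
fromℕ-* (suc m) n = trans (fromℕ-+ n (m *ₙ n)) (trans (cong (fromℕ n +_) (fromℕ-* m n))
  (solve 2 (λ x y → y :+ x :* y := (con 1ℚ :+ x) :* y) refl (fromℕ m) (fromℕ n)))

fromℕ*inv≡1 : ∀ n → fromℕ (suc n) * inv (suc n) ≡ 1ℚ
fromℕ*inv≡1 n = ℚP.toℚᵘ-injective (ℚᵘP.≃-trans (ℚP.toℚᵘ-homo-* (fromℕ (suc n)) (inv (suc n)))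
  (ℚᵘP.≃-trans (ℚᵘP.*-cong (toℚᵘ-fromℕ (suc n)) (ℚP.toℚᵘ-fromℚᵘ (ℚᵘ.mkℚᵘ (ℤ.+ 1) n)))
               (ℚᵘP.*-inverseʳ (ℚᵘ.mkℚᵘ (ℤ.+ suc n) 0))))

*-monoˡ-≤ : ∀ {r p q} → 0ℚ ≤ℚ r → p ≤ℚ q → r * p ≤ℚ r * q
*-monoˡ-≤ {r} 0≤r = ℚP.*-monoˡ-≤-nonNeg r {{nonNegative 0≤r}}

*-monoʳ-≤ : ∀ {r p q} → 0ℚ ≤ℚ r → p ≤ℚ q → p * r ≤ℚ q * r
*-monoʳ-≤ {r} 0≤r = ℚP.*-monoʳ-≤-nonNeg r {{nonNegative 0≤r}}

*-nonNeg : ∀ {p q} → 0ℚ ≤ℚ p → 0ℚ ≤ℚ q → 0ℚ ≤ℚ p * q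
*-nonNeg {p} {q} 0≤p 0≤q = ℚP.≤-trans (ℚP.≤-reflexive (sym (ℚP.*-zeroˡ q))) (*-monoʳ-≤ 0≤q 0≤p)

+-nonNeg : ∀ {p q} → 0ℚ ≤ℚ p → 0ℚ ≤ℚ q → 0ℚ ≤ℚ p + q
+-nonNeg 0≤p 0≤q = ℚP.+-mono-≤ 0≤p 0≤q

p≤q⇒0≤q-p : ∀ {p q} → p ≤ℚ q → 0ℚ ≤ℚ q - p
p≤q⇒0≤q-p {p} p≤q = ℚP.≤-trans (ℚP.≤-reflexive (sym (ℚP.+-inverseʳ p))) (ℚP.+-monoˡ-≤ (- p) p≤q)

0≤p⇒q-p≤q : ∀ {p q} → 0ℚ ≤ℚ p → q - p ≤ℚ q
0≤p⇒q-p≤q {p} {q} 0≤p = ℚP.≤-trans (ℚP.+-monoʳ-≤ q (ℚP.neg-antimono-≤ 0≤p)) (ℚP.≤-reflexive (ℚP.+-identityʳ q))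

p≤p+q : ∀ p {q} → 0ℚ ≤ℚ q → p ≤ℚ p + q
p≤p+q p 0≤q = ℚP.≤-trans (ℚP.≤-reflexive (sym (ℚP.+-identityʳ p))) (ℚP.+-monoʳ-≤ p 0≤q)

+≤-split : ∀ {p q r} → 0ℚ ≤ℚ p → 0ℚ ≤ℚ q → p + q ≤ℚ r → (p ≤ℚ r) × (q ≤ℚ r)
+≤-split {p} {q} 0≤p 0≤q p+q≤r =
  ℚP.≤-trans (p≤p+q p 0≤q) p+q≤r ,
  ℚP.≤-trans (ℚP.≤-trans (p≤p+q q 0≤p) (ℚP.≤-reflexive (ℚP.+-comm q p))) p+q≤r

1≤* : ∀ {p q} → 1ℚ ≤ℚ p → 1ℚ ≤ℚ q → 1ℚ ≤ℚ p * q
1≤* 1≤p 1≤q = ℚP.≤-trans (ℚP.≤-reflexive (sym (ℚP.*-identityˡ 1ℚ)))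
  (ℚP.≤-trans (*-monoʳ-≤ (ℚP.nonNegative⁻¹ 1ℚ) 1≤p) (*-monoˡ-≤ (ℚP.≤-trans (ℚP.nonNegative⁻¹ 1ℚ) 1≤p) 1≤q))

0≤fromℕ : ∀ n → 0ℚ ≤ℚ fromℕ n
0≤fromℕ zero    = ℚP.≤-refl
0≤fromℕ (suc n) = +-nonNeg (ℚP.nonNegative⁻¹ 1ℚ) (0≤fromℕ n)

1≤fromℕ-suc : ∀ n → 1ℚ ≤ℚ fromℕ (suc n)
1≤fromℕ-suc n = p≤p+q 1ℚ (0≤fromℕ n)

fromℕ-mono-≤ : ∀ {m n} → m ≤ n → fromℕ m ≤ℚ fromℕ n
fromℕ-mono-≤ {m} {n} m≤n = subst (λ k → fromℕ m ≤ℚ fromℕ k) (ℕP.m+[n∸m]≡n m≤n)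
  (subst (fromℕ m ≤ℚ_) (sym (fromℕ-+ m (n ∸ m))) (p≤p+q (fromℕ m) (0≤fromℕ (n ∸ m))))

0≤inv : ∀ n → 0ℚ ≤ℚ inv n
0≤inv zero    = ℚP.≤-refl
0≤inv (suc n) = ℚP.nonNegative⁻¹ _ {{ℚP.normalize-nonNeg 1 (suc n)}}

inv-antimono-≤ : ∀ {m n} → 1 ≤ m → m ≤ n → inv n ≤ℚ inv m
inv-antimono-≤ {suc m} {suc n} _ m≤n = begin
  inv (suc n)                                   ≡⟨ sym (ℚP.*-identityˡ _) ⟩
  1ℚ * inv (suc n)                              ≡⟨ cong (_* inv (suc n)) (sym (trans (ℚP.*-comm (inv (suc m)) _) (fromℕ*inv≡1 m))) ⟩
  (inv (suc m) * fromℕ (suc m)) * inv (suc n)   ≡⟨ ℚP.*-assoc (inv (suc m)) _ _ ⟩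
  inv (suc m) * (fromℕ (suc m) * inv (suc n))   ≤⟨ *-monoˡ-≤ (0≤inv (suc m)) (*-monoʳ-≤ (0≤inv (suc n)) (fromℕ-mono-≤ m≤n)) ⟩
  inv (suc m) * (fromℕ (suc n) * inv (suc n))   ≡⟨ cong (inv (suc m) *_) (fromℕ*inv≡1 n) ⟩
  inv (suc m) * 1ℚ                              ≡⟨ ℚP.*-identityʳ _ ⟩
  inv (suc m)                                   ∎
  where open ℚP.≤-Reasoning

inv≤1 : ∀ n → inv (suc n) ≤ℚ 1ℚ
inv≤1 n = inv-antimono-≤ {1} {suc n} (s≤s z≤n) (s≤s z≤n)

inv-partialFractions : ∀ d p q → 1 ≤ d → 1 ≤ p → d +ₙ p ≡ q → inv d * (inv p - inv q) ≡ inv p * inv q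
inv-partialFractions (suc d) (suc p) q _ _ refl = begin
  D * (P - Q)                                   ≡⟨ cong (λ w → D * (P - w)) (sym (ℚP.*-identityʳ Q)) ⟩
  D * (P - Q * 1ℚ)                              ≡⟨ cong (λ w → D * (P - Q * w)) (sym (fromℕ*inv≡1 p)) ⟩
  D * (P - Q * (p′ * P))                        ≡⟨ cong (λ w → D * (w - Q * (p′ * P))) (sym (ℚP.*-identityʳ P)) ⟩
  D * (P * 1ℚ - Q * (p′ * P))                   ≡⟨ cong (λ w → D * (P * w - Q * (p′ * P))) (sym (fromℕ*inv≡1 (d +ₙ suc p))) ⟩
  D * (P * (fromℕ q * Q) - Q * (p′ * P))        ≡⟨ cong (λ w → D * (P * (w * Q) - Q * (p′ * P))) (fromℕ-+ (suc d) (suc p)) ⟩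
  D * (P * ((d′ + p′) * Q) - Q * (p′ * P))      ≡⟨ solve 5 (λ D P Q d′ p′ → D :* (P :* ((d′ :+ p′) :* Q) :- Q :* (p′ :* P)) := (d′ :* D) :* (P :* Q)) refl D P Q d′ p′ ⟩
  (d′ * D) * (P * Q)                            ≡⟨ cong (_* (P * Q)) (fromℕ*inv≡1 d) ⟩
  1ℚ * (P * Q)                                  ≡⟨ ℚP.*-identityˡ _ ⟩
  P * Q                                         ∎
  where
  open ≡-Reasoning
  D = inv (suc d); P = inv (suc p); Q = inv q
  d′ = fromℕ (suc d); p′ = fromℕ (suc p)

fromℕ-unbounded : ∀ q → ∃ λ a → q ≤ℚ fromℕ a
fromℕ-unbounded (mkℚ (ℤ.+ a) d _) =
  a , ℚP.toℚᵘ-cancel-≤ (ℚᵘP.≤-respʳ-≃ (ℚᵘP.≃-sym (toℚᵘ-fromℕ a)) (ℚᵘ.*≤* a*1≤a*[1+d]))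
  where
  a*1≤a*[1+d] : ℤ.+ a ℤ.* ℤ.+ 1 ℤ.≤ ℤ.+ a ℤ.* ℤ.+ suc d
  a*1≤a*[1+d] rewrite ZP.+◃n≡+n (a *ₙ 1) | ZP.+◃n≡+n (a *ₙ suc d) = ℤ.+≤+ (ℕP.*-monoʳ-≤ a (s≤s z≤n))
fromℕ-unbounded (mkℚ ℤ.-[1+ _ ] _ _) = 0 , ℚP.toℚᵘ-cancel-≤ (ℚᵘ.*≤* ℤ.-≤+)

archimedean : ∀ A ε → 0ℚ <ℚ ε → ∃ λ n → A <ℚ ε * fromℕ n
archimedean A ε@(mkℚ (ℤ.+ suc p) q _) _ with fromℕ-unbounded A
... | a , A≤a = suc q *ₙ suc a , ℚP.≤-<-trans A≤a (ℚP.<-≤-trans a<1+a 1+a≤ε*n)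
  where
  inv≤ε : inv (suc q) ≤ℚ ε
  inv≤ε = ℚP.toℚᵘ-cancel-≤ (ℚᵘP.≤-respˡ-≃ (ℚᵘP.≃-sym (ℚP.toℚᵘ-fromℚᵘ (ℚᵘ.mkℚᵘ (ℤ.+ 1) q)))
                                          (ℚᵘ.*≤* (ℤ.+≤+ (ℕP.*-monoˡ-≤ (suc q) (s≤s (z≤n {p}))))))
  a<1+a : fromℕ a <ℚ fromℕ (suc a)
  a<1+a = ℚP.≤-<-trans (ℚP.≤-reflexive (sym (ℚP.+-identityˡ (fromℕ a)))) (ℚP.+-monoˡ-< (fromℕ a) (ℚP.positive⁻¹ 1ℚ))
  1+a≤ε*n : fromℕ (suc a) ≤ℚ ε * fromℕ (suc q *ₙ suc a)
  1+a≤ε*n = begin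
    fromℕ (suc a)                                   ≡⟨ sym (ℚP.*-identityˡ _) ⟩
    1ℚ * fromℕ (suc a)                              ≡⟨ cong (_* fromℕ (suc a)) (sym (trans (ℚP.*-comm (inv (suc q)) _) (fromℕ*inv≡1 q))) ⟩
    (inv (suc q) * fromℕ (suc q)) * fromℕ (suc a)   ≤⟨ *-monoʳ-≤ (0≤fromℕ (suc a)) (*-monoʳ-≤ (0≤fromℕ (suc q)) inv≤ε) ⟩
    (ε * fromℕ (suc q)) * fromℕ (suc a)             ≡⟨ ℚP.*-assoc ε (fromℕ (suc q)) (fromℕ (suc a)) ⟩
    ε * (fromℕ (suc q) * fromℕ (suc a))             ≡⟨ cong (ε *_) (sym (fromℕ-* (suc q) (suc a))) ⟩
    ε * fromℕ (suc q *ₙ suc a)                      ∎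
    where open ℚP.≤-Reasoning
archimedean A (mkℚ (ℤ.+ zero) _ _) 0<ε with () ← positive 0<ε
archimedean A (mkℚ ℤ.-[1+ _ ] _ _) 0<ε with () ← positive 0<ε

0<p⇒0<p*p : ∀ {p} → 0ℚ <ℚ p → 0ℚ <ℚ p * p
0<p⇒0<p*p {p} 0<p = ℚP.positive⁻¹ (p * p) {{ℚP.pos*pos⇒pos p {{positive 0<p}} p {{positive 0<p}}}}

square-<⇒< : ∀ {x ε} → 0ℚ ≤ℚ x → 0ℚ <ℚ ε → x * x <ℚ ε * ε → x <ℚ ε
square-<⇒< {x} {ε} 0≤x 0<ε xx<εε with x ℚP.<? ε
... | yes x<ε = x<ε
... | no  x≮ε = ⊥-elim (ℚP.<-irrefl refl (ℚP.≤-<-trans εε≤xx xx<εε))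
  where
  ε≤x = ℚP.≮⇒≥ x≮ε
  εε≤xx = ℚP.≤-trans (*-monoʳ-≤ (ℚP.<⇒≤ 0<ε) ε≤x) (*-monoˡ-≤ 0≤x ε≤x)

∑ : {A : Set} → List A → (A → ℚ) → ℚ
∑ xs f = sumℚ (map f xs)

syntax ∑ xs (λ x → e) = ∑[ x ∈ xs ] e

when : Bool → ℚ → ℚ
when b x = if b then x else 0ℚ

module _ {A : Set} where

  ∑-cong : (xs : List A) {f g : A → ℚ} → (∀ x → x ∈ xs → f x ≡ g x) → ∑ xs f ≡ ∑ xs g
  ∑-cong []       f≡g = refl
  ∑-cong (x ∷ xs) f≡g = cong₂ _+_ (f≡g x (here refl)) (∑-cong xs (λ y y∈xs → f≡g y (there y∈xs)))

  ∑-ext : (xs : List A) {f g : A → ℚ} → (∀ x → f x ≡ g x) → ∑ xs f ≡ ∑ xs g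
  ∑-ext xs f≡g = ∑-cong xs (λ x _ → f≡g x)

  ∑-mono : (xs : List A) {f g : A → ℚ} → (∀ x → x ∈ xs → f x ≤ℚ g x) → ∑ xs f ≤ℚ ∑ xs g
  ∑-mono []       f≤g = ℚP.≤-refl
  ∑-mono (x ∷ xs) f≤g = ℚP.+-mono-≤ (f≤g x (here refl)) (∑-mono xs (λ y y∈xs → f≤g y (there y∈xs)))

  ∑-nonNeg : (xs : List A) {f : A → ℚ} → (∀ x → x ∈ xs → 0ℚ ≤ℚ f x) → 0ℚ ≤ℚ ∑ xs f
  ∑-nonNeg []       0≤f = ℚP.≤-refl
  ∑-nonNeg (x ∷ xs) 0≤f = +-nonNeg (0≤f x (here refl)) (∑-nonNeg xs (λ y y∈xs → 0≤f y (there y∈xs)))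

  ∑-zero : (xs : List A) → ∑[ x ∈ xs ] 0ℚ ≡ 0ℚ
  ∑-zero []       = refl
  ∑-zero (x ∷ xs) = trans (cong (0ℚ +_) (∑-zero xs)) (ℚP.+-identityˡ 0ℚ)

  ∑-+ : (xs : List A) (f g : A → ℚ) → ∑[ x ∈ xs ] (f x + g x) ≡ ∑ xs f + ∑ xs g
  ∑-+ []       f g = sym (ℚP.+-identityˡ 0ℚ)
  ∑-+ (x ∷ xs) f g = trans (cong (f x + g x +_) (∑-+ xs f g))
    (solve 4 (λ a b c d → a :+ b :+ (c :+ d) := a :+ c :+ (b :+ d)) refl (f x) (g x) (∑ xs f) (∑ xs g))

  ∑-neg : (xs : List A) (f : A → ℚ) → ∑[ x ∈ xs ] (- f x) ≡ - ∑ xs f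
  ∑-neg []       f = refl
  ∑-neg (x ∷ xs) f = trans (cong (- f x +_) (∑-neg xs f)) (sym (ℚP.neg-distrib-+ (f x) (∑ xs f)))

  ∑-- : (xs : List A) (f g : A → ℚ) → ∑[ x ∈ xs ] (f x - g x) ≡ ∑ xs f - ∑ xs g
  ∑-- xs f g = trans (∑-+ xs f (λ x → - g x)) (cong (∑ xs f +_) (∑-neg xs g))

  ∑-*ˡ : (xs : List A) (c : ℚ) (f : A → ℚ) → ∑[ x ∈ xs ] (c * f x) ≡ c * ∑ xs f
  ∑-*ˡ []       c f = sym (ℚP.*-zeroʳ c)
  ∑-*ˡ (x ∷ xs) c f = trans (cong (c * f x +_) (∑-*ˡ xs c f)) (sym (ℚP.*-distribˡ-+ c (f x) (∑ xs f)))

  ∑-*ʳ : (xs : List A) (c : ℚ) (f : A → ℚ) → ∑[ x ∈ xs ] (f x * c) ≡ ∑ xs f * c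
  ∑-*ʳ xs c f = trans (∑-ext xs (λ x → ℚP.*-comm (f x) c)) (trans (∑-*ˡ xs c f) (ℚP.*-comm c (∑ xs f)))

  ∑-++ : (xs ys : List A) (f : A → ℚ) → ∑ (xs ++ ys) f ≡ ∑ xs f + ∑ ys f
  ∑-++ []       ys f = sym (ℚP.+-identityˡ _)
  ∑-++ (x ∷ xs) ys f = trans (cong (f x +_) (∑-++ xs ys f)) (sym (ℚP.+-assoc (f x) (∑ xs f) (∑ ys f)))

  ∑-map : {B : Set} (h : B → A) (xs : List B) (f : A → ℚ) → ∑ (map h xs) f ≡ ∑ xs (f ∘ h)
  ∑-map h []       f = refl
  ∑-map h (x ∷ xs) f = cong (f (h x) +_) (∑-map h xs f)

  ∑-filter : {P : A → Set} (P? : ∀ x → Dec (P x)) (xs : List A) (f : A → ℚ) →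
             ∑ (filter P? xs) f ≡ ∑[ x ∈ xs ] when (does (P? x)) (f x)
  ∑-filter P? []       f = refl
  ∑-filter P? (x ∷ xs) f with does (P? x)
  ... | true  = cong (f x +_) (∑-filter P? xs f)
  ... | false = trans (∑-filter P? xs f) (sym (ℚP.+-identityˡ _))

∑-concatMap : {A B : Set} (h : A → List B) (xs : List A) (f : B → ℚ) →
              ∑ (concatMap h xs) f ≡ ∑[ x ∈ xs ] ∑ (h x) f
∑-concatMap h []       f = refl
∑-concatMap h (x ∷ xs) f = trans (∑-++ (h x) (concatMap h xs) f) (cong (∑ (h x) f +_) (∑-concatMap h xs f))

∑-comm : {A B : Set} (xs : List A) (ys : List B) (f : A → B → ℚ) →
         ∑[ x ∈ xs ] ∑[ y ∈ ys ] f x y ≡ ∑[ y ∈ ys ] ∑[ x ∈ xs ] f x y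
∑-comm []       ys f = sym (∑-zero ys)
∑-comm (x ∷ xs) ys f = trans (cong (∑ ys (f x) +_) (∑-comm xs ys f)) (sym (∑-+ ys (f x) _))

when-*ˡ : ∀ b c x → c * when b x ≡ when b (c * x)
when-*ˡ true  c x = refl
when-*ˡ false c x = ℚP.*-zeroʳ c

when-swap : ∀ b x y → x * when b y ≡ when b x * y
when-swap true  x y = refl
when-swap false x y = trans (ℚP.*-zeroʳ x) (sym (ℚP.*-zeroˡ y))

0≤when : ∀ b {x} → 0ℚ ≤ℚ x → 0ℚ ≤ℚ when b x
0≤when true  0≤x = 0≤x
0≤when false _   = ℚP.≤-refl

when-≤-yes : ∀ {m n} x → m ≤ n → when (does (m ≤? n)) x ≡ x
when-≤-yes {m} {n} x m≤n rewrite dec-true (m ≤? n) m≤n = refl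

when-≤-no : ∀ {m n} x → ¬ m ≤ n → when (does (m ≤? n)) x ≡ 0ℚ
when-≤-no {m} {n} x m≰n rewrite dec-false (m ≤? n) m≰n = refl

applyUpTo-cong : {A : Set} (f g : ℕ → A) (n : ℕ) → (∀ i → f i ≡ g i) → applyUpTo f n ≡ applyUpTo g n
applyUpTo-cong f g zero    f≡g = refl
applyUpTo-cong f g (suc n) f≡g = cong₂ _∷_ (f≡g 0) (applyUpTo-cong (f ∘ suc) (g ∘ suc) n (f≡g ∘ suc))

range-nil : ∀ {lo hi} → hi < lo → range lo hi ≡ []
range-nil hi<lo rewrite ℕP.m≤n⇒m∸n≡0 hi<lo = refl

range-cons : ∀ {lo hi} → lo ≤ hi → range lo hi ≡ lo ∷ range (suc lo) hi
range-cons {lo} {hi} lo≤hi rewrite ℕP.+-∸-assoc 1 lo≤hi =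
  cong₂ _∷_ (ℕP.+-identityʳ lo) (applyUpTo-cong _ _ (hi ∸ lo) (ℕP.+-suc lo))

range-snoc : ∀ {lo hi} → lo ≤ suc hi → range lo (suc hi) ≡ range lo hi ++ [ suc hi ]
range-snoc {lo} {hi} lo≤1+hi rewrite ℕP.+-∸-assoc 1 lo≤1+hi =
  trans (sym (ListP.applyUpTo-∷ʳ (lo +ₙ_) (suc hi ∸ lo))) (cong (λ w → range lo hi ++ [ w ]) (ℕP.m+[n∸m]≡n lo≤1+hi))

range-split : ∀ {lo m hi} → lo ≤ suc m → m ≤ hi → range lo hi ≡ range lo m ++ range (suc m) hi
range-split {hi = zero} _ z≤n = sym (ListP.++-identityʳ _)
range-split {lo} {m} {suc hi} lo≤1+m m≤1+hi with ℕP.m≤n⇒m<n∨m≡n m≤1+hi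
... | inj₂ refl = sym (trans (cong (range lo (suc hi) ++_) (range-nil (ℕP.n<1+n (suc hi)))) (ListP.++-identityʳ _))
... | inj₁ m<1+hi = begin
  range lo (suc hi)                                   ≡⟨ range-snoc (ℕP.≤-trans lo≤1+m m<1+hi) ⟩
  range lo hi ++ [ suc hi ]                           ≡⟨ cong (_++ [ suc hi ]) (range-split lo≤1+m (ℕP.≤-pred m<1+hi)) ⟩
  (range lo m ++ range (suc m) hi) ++ [ suc hi ]      ≡⟨ ListP.++-assoc (range lo m) _ _ ⟩
  range lo m ++ (range (suc m) hi ++ [ suc hi ])      ≡⟨ cong (range lo m ++_) (sym (range-snoc m<1+hi)) ⟩
  range lo m ++ range (suc m) (suc hi)                ∎
  where open ≡-Reasoning

∈-range⁻ : ∀ {lo hi x} → x ∈ range lo hi → lo ≤ x × x ≤ hi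
∈-range⁻ {lo} {hi} x∈ with ∈-applyUpTo⁻ (lo +ₙ_) x∈
... | i , i<n , refl = ℕP.m≤m+n lo i , subst (_≤ hi) (ℕP.+-comm i lo) (ℕP.≤-pred (ℕP.m≤o∸n⇒m+n≤o (suc i) lo≤1+hi i<n))
  where lo≤1+hi = ℕP.<⇒≤ (ℕP.m∸n≢0⇒n<m (λ eq → ℕP.n≮0 (subst (i <_) eq i<n)))

∑-cons : ∀ lo hi (f : ℕ → ℚ) → lo ≤ hi → ∑ (range lo hi) f ≡ f lo + ∑ (range (suc lo) hi) f
∑-cons lo hi f lo≤hi = cong (λ xs → ∑ xs f) (range-cons lo≤hi)

∑-snoc : ∀ lo hi (f : ℕ → ℚ) → lo ≤ suc hi → ∑ (range lo (suc hi)) f ≡ ∑ (range lo hi) f + f (suc hi)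
∑-snoc lo hi f lo≤1+hi = trans (cong (λ xs → ∑ xs f) (range-snoc lo≤1+hi))
  (trans (∑-++ (range lo hi) [ suc hi ] f) (cong (∑ (range lo hi) f +_) (ℚP.+-identityʳ (f (suc hi)))))

∑-split : ∀ lo m hi (f : ℕ → ℚ) → lo ≤ suc m → m ≤ hi →
          ∑ (range lo hi) f ≡ ∑ (range lo m) f + ∑ (range (suc m) hi) f
∑-split lo m hi f lo≤1+m m≤hi = trans (cong (λ xs → ∑ xs f) (range-split lo≤1+m m≤hi)) (∑-++ (range lo m) _ f)

∑-shift : ∀ lo hi (f : ℕ → ℚ) → ∑ (range (suc lo) (suc hi)) f ≡ ∑ (range lo hi) (f ∘ suc)
∑-shift lo hi f = trans (cong sumℚ (ListP.map-applyUpTo (suc lo +ₙ_) f (suc hi ∸ lo)))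
                       (sym (cong sumℚ (ListP.map-applyUpTo (lo +ₙ_) (f ∘ suc) (suc hi ∸ lo))))

module _ (lo hi : ℕ) where

  ∑-congᵣ : {f g : ℕ → ℚ} → (∀ n → lo ≤ n → n ≤ hi → f n ≡ g n) → ∑ (range lo hi) f ≡ ∑ (range lo hi) g
  ∑-congᵣ f≡g = ∑-cong (range lo hi) (λ n n∈ → f≡g n (proj₁ (∈-range⁻ n∈)) (proj₂ (∈-range⁻ n∈)))

  ∑-monoᵣ : {f g : ℕ → ℚ} → (∀ n → lo ≤ n → n ≤ hi → f n ≤ℚ g n) → ∑ (range lo hi) f ≤ℚ ∑ (range lo hi) g
  ∑-monoᵣ f≤g = ∑-mono (range lo hi) (λ n n∈ → f≤g n (proj₁ (∈-range⁻ n∈)) (proj₂ (∈-range⁻ n∈)))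

  ∑-nonNegᵣ : {f : ℕ → ℚ} → (∀ n → lo ≤ n → n ≤ hi → 0ℚ ≤ℚ f n) → 0ℚ ≤ℚ ∑ (range lo hi) f
  ∑-nonNegᵣ 0≤f = ∑-nonNeg (range lo hi) (λ n n∈ → 0≤f n (proj₁ (∈-range⁻ n∈)) (proj₂ (∈-range⁻ n∈)))

  ∑-zeroᵣ : {f : ℕ → ℚ} → (∀ n → lo ≤ n → n ≤ hi → f n ≡ 0ℚ) → ∑ (range lo hi) f ≡ 0ℚ
  ∑-zeroᵣ f≡0 = trans (∑-congᵣ f≡0) (∑-zero (range lo hi))

∑-telescope : ∀ (g : ℕ → ℚ) lo hi → lo ≤ suc hi → ∑[ m ∈ range lo hi ] (g m - g (suc m)) ≡ g lo - g (suc hi)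
∑-telescope g lo hi lo≤1+hi = byLength (suc hi ∸ lo) lo (ℕP.m∸n+n≡m lo≤1+hi)
  where
  byLength : ∀ k lo → k +ₙ lo ≡ suc hi → ∑[ m ∈ range lo hi ] (g m - g (suc m)) ≡ g lo - g (suc hi)
  byLength zero    lo refl = trans (cong (λ xs → ∑ xs _) (range-nil (ℕP.n<1+n hi))) (sym (ℚP.+-inverseʳ (g (suc hi))))
  byLength (suc k) lo eq   = trans (∑-cons lo hi _ lo≤hi)
    (trans (cong (g lo - g (suc lo) +_) (byLength k (suc lo) (trans (ℕP.+-suc k lo) eq)))
           (solve 3 (λ a b c → a :- b :+ (b :- c) := a :- c) refl (g lo) (g (suc lo)) (g (suc hi))))
    where lo≤hi = ℕP.≤-pred (subst (suc lo ≤_) eq (s≤s (ℕP.m≤n+m lo k)))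

∑-reflect : ∀ z (f : ℕ → ℚ) → ∑ (range 1 z) f ≡ ∑[ n ∈ range 1 z ] f (suc z ∸ n)
∑-reflect zero    f = refl
∑-reflect (suc z) f = begin
  ∑ (range 1 (suc z)) f                                          ≡⟨ ∑-snoc 1 z f (s≤s z≤n) ⟩
  ∑ (range 1 z) f + f (suc z)                                    ≡⟨ cong (_+ f (suc z)) (∑-reflect z f) ⟩
  ∑[ n ∈ range 1 z ] f (suc z ∸ n) + f (suc z)                   ≡⟨ ℚP.+-comm _ (f (suc z)) ⟩
  f (suc z) + ∑[ n ∈ range 1 z ] f (suc z ∸ n)                   ≡⟨ cong (f (suc z) +_) (sym (∑-shift 1 z _)) ⟩
  f (suc z) + ∑[ n ∈ range 2 (suc z) ] f (suc (suc z) ∸ n)       ≡⟨ sym (∑-cons 1 (suc z) (λ n → f (suc (suc z) ∸ n)) (s≤s z≤n)) ⟩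
  ∑[ n ∈ range 1 (suc z) ] f (suc (suc z) ∸ n)                   ∎
  where open ≡-Reasoning

∑-restrict-≥ : ∀ z n (g : ℕ → ℚ) → 1 ≤ n → n ≤ suc z →
               ∑[ t ∈ range 1 z ] when (does (n ≤? t)) (g t) ≡ ∑ (range n z) g
∑-restrict-≥ z (suc n) g _ n<1+z = begin
  ∑ (range 1 z) G                                  ≡⟨ ∑-split 1 n z G (s≤s z≤n) (ℕP.≤-pred n<1+z) ⟩
  ∑ (range 1 n) G + ∑ (range (suc n) z) G          ≡⟨ cong₂ _+_ (∑-zeroᵣ 1 n (λ t _ t≤n → when-≤-no (g t) (ℕP.<⇒≱ (s≤s t≤n))))
                                                                (∑-congᵣ (suc n) z (λ t n<t _ → when-≤-yes (g t) n<t)) ⟩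
  0ℚ + ∑ (range (suc n) z) g                       ≡⟨ ℚP.+-identityˡ _ ⟩
  ∑ (range (suc n) z) g                            ∎
  where
  open ≡-Reasoning
  G = λ t → when (does (suc n ≤? t)) (g t)

∑-restrict-≤ : ∀ z n (g : ℕ → ℚ) → n ≤ z →
               ∑[ t ∈ range 1 z ] when (does (t ≤? n)) (g t) ≡ ∑ (range 1 n) g
∑-restrict-≤ z n g n≤z = begin
  ∑ (range 1 z) G                                  ≡⟨ ∑-split 1 n z G (s≤s z≤n) n≤z ⟩
  ∑ (range 1 n) G + ∑ (range (suc n) z) G          ≡⟨ cong₂ _+_ (∑-congᵣ 1 n (λ t _ t≤n → when-≤-yes (g t) t≤n))
                                                                (∑-zeroᵣ (suc n) z (λ t n<t _ → when-≤-no (g t) (ℕP.<⇒≱ n<t))) ⟩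
  ∑ (range 1 n) g + 0ℚ                             ≡⟨ ℚP.+-identityʳ _ ⟩
  ∑ (range 1 n) g                                  ∎
  where
  open ≡-Reasoning
  G = λ t → when (does (t ≤? n)) (g t)

Vector : Set
Vector = ℕ → ℚ

data Op : Set where
  prefix suffix divIndex divCoindex : Op

transpose : Op → Op
transpose prefix     = suffix
transpose suffix     = prefix
transpose divIndex   = divIndex
transpose divCoindex = divCoindex

mirror : Op → Op
mirror prefix     = suffix
mirror suffix     = prefix
mirror divIndex   = divCoindex
mirror divCoindex = divIndex

swapDiv : Op → Op
swapDiv = mirror ∘ transpose

reverseMap : (Op → Op) → List Op → List Op
reverseMap f w = reverse (map f w)

_^ʷ_ : List Op → ℕ → List Op
w ^ʷ zero  = []
w ^ʷ suc n = w ++ w ^ʷ n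

reverseMap-++ : ∀ f xs ys → reverseMap f (xs ++ ys) ≡ reverseMap f ys ++ reverseMap f xs
reverseMap-++ f xs ys = trans (cong reverse (ListP.map-++ f xs ys)) (ListP.reverse-++ (map f xs) (map f ys))

^ʷ-comm : ∀ w n → w ++ w ^ʷ n ≡ w ^ʷ n ++ w
^ʷ-comm w zero    = ListP.++-identityʳ w
^ʷ-comm w (suc n) = trans (cong (w ++_) (^ʷ-comm w n)) (sym (ListP.++-assoc w (w ^ʷ n) w))

reverseMap-^ʷ : ∀ f w n → reverseMap f (w ^ʷ n) ≡ reverseMap f w ^ʷ n
reverseMap-^ʷ f w zero    = refl
reverseMap-^ʷ f w (suc n) = begin
  reverseMap f (w ++ w ^ʷ n)                     ≡⟨ reverseMap-++ f w (w ^ʷ n) ⟩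
  reverseMap f (w ^ʷ n) ++ reverseMap f w        ≡⟨ cong (_++ reverseMap f w) (reverseMap-^ʷ f w n) ⟩
  reverseMap f w ^ʷ n ++ reverseMap f w          ≡⟨ sym (^ʷ-comm (reverseMap f w) n) ⟩
  reverseMap f w ^ʷ suc n                        ∎
  where open ≡-Reasoning

module Operators (z : ℕ) where

  _≐_ : Vector → Vector → Set
  u ≐ v = ∀ n → 1 ≤ n → n ≤ z → u n ≡ v n

  ⟨_,_⟩ : Vector → Vector → ℚ
  ⟨ u , v ⟩ = ∑[ n ∈ range 1 z ] (u n * v n)

  one : Vector
  one _ = 1ℚ

  reflect : Vector → Vector
  reflect v n = v (suc z ∸ n)

  ⟦_⟧ : Op → Vector → Vector
  ⟦ prefix     ⟧ v t = ∑[ m ∈ range 1 z ] when (does (m ≤? t)) (v m)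
  ⟦ suffix     ⟧ v t = ∑[ m ∈ range 1 z ] when (does (t ≤? m)) (v m)
  ⟦ divIndex   ⟧ v n = inv n * v n
  ⟦ divCoindex ⟧ v n = inv (suc z ∸ n) * v n

  ⟦_⟧* : List Op → Vector → Vector
  ⟦ []    ⟧* v = v
  ⟦ o ∷ w ⟧* v = ⟦ o ⟧ (⟦ w ⟧* v)

  ⟦⟧*-++ : ∀ xs ys v → ⟦ xs ++ ys ⟧* v ≡ ⟦ xs ⟧* (⟦ ys ⟧* v)
  ⟦⟧*-++ []       ys v = refl
  ⟦⟧*-++ (o ∷ xs) ys v = cong ⟦ o ⟧ (⟦⟧*-++ xs ys v)

  ⟨⟩-comm : ∀ u v → ⟨ u , v ⟩ ≡ ⟨ v , u ⟩
  ⟨⟩-comm u v = ∑-ext (range 1 z) (λ n → ℚP.*-comm (u n) (v n))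

  ⟨⟩-cong : ∀ {u u′ v v′} → u ≐ u′ → v ≐ v′ → ⟨ u , v ⟩ ≡ ⟨ u′ , v′ ⟩
  ⟨⟩-cong u≐u′ v≐v′ = ∑-congᵣ 1 z (λ n 1≤n n≤z → cong₂ _*_ (u≐u′ n 1≤n n≤z) (v≐v′ n 1≤n n≤z))

  suffix-cong : ∀ {u v} → u ≐ v → ∀ t → ⟦ suffix ⟧ u t ≡ ⟦ suffix ⟧ v t
  suffix-cong u≐v t = ∑-congᵣ 1 z (λ m 1≤m m≤z → cong (when _) (u≐v m 1≤m m≤z))

  ⟦⟧-cong : ∀ o {u v} → u ≐ v → ⟦ o ⟧ u ≐ ⟦ o ⟧ v
  ⟦⟧-cong prefix     u≐v t _ _ = ∑-congᵣ 1 z (λ m 1≤m m≤z → cong (when _) (u≐v m 1≤m m≤z))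
  ⟦⟧-cong suffix     u≐v t _ _ = suffix-cong u≐v t
  ⟦⟧-cong divIndex   u≐v n 1≤n n≤z = cong (inv n *_) (u≐v n 1≤n n≤z)
  ⟦⟧-cong divCoindex u≐v n 1≤n n≤z = cong (inv (suc z ∸ n) *_) (u≐v n 1≤n n≤z)

  ⟦⟧*-cong : ∀ w {u v} → u ≐ v → ⟦ w ⟧* u ≐ ⟦ w ⟧* v
  ⟦⟧*-cong []      u≐v = u≐v
  ⟦⟧*-cong (o ∷ w) u≐v = ⟦⟧-cong o (⟦⟧*-cong w u≐v)

  adjoint-prefix : ∀ u v → ⟨ u , ⟦ prefix ⟧ v ⟩ ≡ ⟨ ⟦ suffix ⟧ u , v ⟩
  adjoint-prefix u v = begin
    ∑[ t ∈ R ] (u t * ∑[ m ∈ R ] when (does (m ≤? t)) (v m))      ≡⟨ ∑-ext R (λ t → sym (∑-*ˡ R (u t) _)) ⟩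
    ∑[ t ∈ R ] ∑[ m ∈ R ] (u t * when (does (m ≤? t)) (v m))      ≡⟨ ∑-ext R (λ t → ∑-ext R (λ m → when-swap _ (u t) (v m))) ⟩
    ∑[ t ∈ R ] ∑[ m ∈ R ] (when (does (m ≤? t)) (u t) * v m)      ≡⟨ ∑-comm R R _ ⟩
    ∑[ m ∈ R ] ∑[ t ∈ R ] (when (does (m ≤? t)) (u t) * v m)      ≡⟨ ∑-ext R (λ m → ∑-*ʳ R (v m) _) ⟩
    ∑[ m ∈ R ] (⟦ suffix ⟧ u m * v m)                              ∎
    where
    open ≡-Reasoning
    R = range 1 z

  adjoint : ∀ o u v → ⟨ u , ⟦ o ⟧ v ⟩ ≡ ⟨ ⟦ transpose o ⟧ u , v ⟩
  adjoint prefix     u v = adjoint-prefix u v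
  adjoint suffix     u v = trans (⟨⟩-comm u _) (trans (sym (adjoint-prefix v u)) (⟨⟩-comm v _))
  adjoint divIndex   u v = ∑-ext (range 1 z) (λ n → solve 3 (λ a b c → a :* (b :* c) := b :* a :* c) refl (u n) (inv n) (v n))
  adjoint divCoindex u v = ∑-ext (range 1 z) (λ n → solve 3 (λ a b c → a :* (b :* c) := b :* a :* c) refl (u n) (inv (suc z ∸ n)) (v n))

  adjoint* : ∀ w u v → ⟨ u , ⟦ w ⟧* v ⟩ ≡ ⟨ ⟦ reverseMap transpose w ⟧* u , v ⟩
  adjoint* []      u v = refl
  adjoint* (o ∷ w) u v = begin
    ⟨ u , ⟦ o ⟧ (⟦ w ⟧* v) ⟩                                           ≡⟨ adjoint o u _ ⟩
    ⟨ ⟦ transpose o ⟧ u , ⟦ w ⟧* v ⟩                                   ≡⟨ adjoint* w _ v ⟩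
    ⟨ ⟦ reverseMap transpose w ⟧* (⟦ transpose o ⟧ u) , v ⟩            ≡⟨ cong (⟨_, v ⟩) (sym (⟦⟧*-++ (reverseMap transpose w) [ transpose o ] u)) ⟩
    ⟨ ⟦ reverseMap transpose w ++ [ transpose o ] ⟧* u , v ⟩           ≡⟨ cong (λ w′ → ⟨ ⟦ w′ ⟧* u , v ⟩) (sym (ListP.unfold-reverse (transpose o) (map transpose w))) ⟩
    ⟨ ⟦ reverseMap transpose (o ∷ w) ⟧* u , v ⟩                        ∎
    where open ≡-Reasoning

  does-≤-reflect : ∀ {m n} → m ≤ suc z → n ≤ suc z → does (suc z ∸ m ≤? suc z ∸ n) ≡ does (n ≤? m)
  does-≤-reflect {m} {n} m≤N n≤N with n ≤? m
  ... | yes n≤m = trans (dec-true  (suc z ∸ m ≤? suc z ∸ n) (ℕP.∸-monoʳ-≤ (suc z) n≤m)) (sym (dec-true (n ≤? m) n≤m))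
  ... | no  n≰m = trans (dec-false (suc z ∸ m ≤? suc z ∸ n) (ℕP.<⇒≱ (ℕP.∸-monoʳ-< (ℕP.≰⇒> n≰m) n≤N))) (sym (dec-false (n ≤? m) n≰m))

  reflect-prefix : ∀ v → reflect (⟦ prefix ⟧ v) ≐ ⟦ suffix ⟧ (reflect v)
  reflect-prefix v n _ n≤z = trans (∑-reflect z _)
    (∑-congᵣ 1 z (λ m _ m≤z → cong (λ b → when b (v (suc z ∸ m))) (does-≤-reflect (ℕP.m≤n⇒m≤1+n m≤z) (ℕP.m≤n⇒m≤1+n n≤z))))

  reflect-suffix : ∀ v → reflect (⟦ suffix ⟧ v) ≐ ⟦ prefix ⟧ (reflect v)
  reflect-suffix v n _ n≤z = trans (∑-reflect z _)
    (∑-congᵣ 1 z (λ m _ m≤z → cong (λ b → when b (v (suc z ∸ m))) (does-≤-reflect (ℕP.m≤n⇒m≤1+n n≤z) (ℕP.m≤n⇒m≤1+n m≤z))))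

  reflect-⟦⟧ : ∀ o v → reflect (⟦ o ⟧ v) ≐ ⟦ mirror o ⟧ (reflect v)
  reflect-⟦⟧ prefix     v = reflect-prefix v
  reflect-⟦⟧ suffix     v = reflect-suffix v
  reflect-⟦⟧ divIndex   v n _ _   = refl
  reflect-⟦⟧ divCoindex v n _ n≤z = cong (λ k → inv k * v (suc z ∸ n)) (ℕP.m∸[m∸n]≡n (ℕP.m≤n⇒m≤1+n n≤z))

  reflect-⟦⟧* : ∀ w v → reflect (⟦ w ⟧* v) ≐ ⟦ map mirror w ⟧* (reflect v)
  reflect-⟦⟧* []      v n _ _ = refl
  reflect-⟦⟧* (o ∷ w) v n 1≤n n≤z =
    trans (reflect-⟦⟧ o (⟦ w ⟧* v) n 1≤n n≤z) (⟦⟧-cong (mirror o) (reflect-⟦⟧* w v) n 1≤n n≤z)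

  ⟨⟩-reflect : ∀ u v → ⟨ u , v ⟩ ≡ ⟨ reflect u , reflect v ⟩
  ⟨⟩-reflect u v = ∑-reflect z (λ n → u n * v n)

  value : List Op → ℚ
  value w = ⟨ one , ⟦ w ⟧* one ⟩

  -- Transposition reverses a word and the reflection n ↦ z + 1 − n exchanges prefix with suffix and
  -- divIndex with divCoindex; together they fix value w and exchange only the two divisions.
  value-reverseMap-swapDiv : ∀ w → value w ≡ value (reverseMap swapDiv w)
  value-reverseMap-swapDiv w = begin
    ⟨ one , ⟦ w ⟧* one ⟩                                      ≡⟨ adjoint* w one one ⟩
    ⟨ ⟦ wᵀ ⟧* one , one ⟩                                     ≡⟨ ⟨⟩-reflect (⟦ wᵀ ⟧* one) one ⟩
    ⟨ reflect (⟦ wᵀ ⟧* one) , one ⟩                           ≡⟨ ⟨⟩-cong (reflect-⟦⟧* wᵀ one) (λ _ _ _ → refl) ⟩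
    ⟨ ⟦ map mirror wᵀ ⟧* one , one ⟩                          ≡⟨ ⟨⟩-comm (⟦ map mirror wᵀ ⟧* one) one ⟩
    ⟨ one , ⟦ map mirror wᵀ ⟧* one ⟩                          ≡⟨ cong (λ w′ → ⟨ one , ⟦ w′ ⟧* one ⟩) mirror-wᵀ ⟩
    ⟨ one , ⟦ reverseMap swapDiv w ⟧* one ⟩                   ∎
    where
    open ≡-Reasoning
    wᵀ = reverseMap transpose w
    mirror-wᵀ : map mirror wᵀ ≡ reverseMap swapDiv w
    mirror-wᵀ = trans (ListP.reverse-map mirror (map transpose w)) (cong reverse (sym (ListP.map-∘ w)))

yWord xWord xᵀWord : List Op
yWord  = prefix ∷ divCoindex ∷ []
xWord  = suffix ∷ divIndex ∷ []
xᵀWord = divIndex ∷ prefix ∷ []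

-- One block of ζ^{⋆♭}, weighted 1 / ((N − n₁) n₂ ⋯ n_k) and summed from n₁ upward, and one
-- block of the limit of G.
ζBlock GBlock : ℕ → List Op
ζBlock k = xᵀWord ^ʷ (k ∸ 1) ++ [ divCoindex ]
GBlock k = divIndex ∷ yWord ^ʷ (k ∸ 1)

blocks : (ℕ → List Op) → List ℕ → List Op
blocks B []           = []
blocks B (k ∷ [])     = B k
blocks B (k ∷ k′ ∷ ks) = B k ++ suffix ∷ blocks B (k′ ∷ ks)

reverseMap-GBlock : ∀ k → reverseMap swapDiv (GBlock k) ≡ ζBlock k
reverseMap-GBlock k = begin
  reverseMap swapDiv (divIndex ∷ yWord ^ʷ (k ∸ 1))                 ≡⟨ ListP.unfold-reverse divCoindex (map swapDiv (yWord ^ʷ (k ∸ 1))) ⟩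
  reverseMap swapDiv (yWord ^ʷ (k ∸ 1)) ++ [ divCoindex ]          ≡⟨ cong (_++ [ divCoindex ]) (reverseMap-^ʷ swapDiv yWord (k ∸ 1)) ⟩
  xᵀWord ^ʷ (k ∸ 1) ++ [ divCoindex ]                              ∎
  where open ≡-Reasoning

blocks-∷ʳ : ∀ B k ks k′ → blocks B (k ∷ ks ++ [ k′ ]) ≡ blocks B (k ∷ ks) ++ suffix ∷ B k′
blocks-∷ʳ B k []       k′ = refl
blocks-∷ʳ B k (x ∷ xs) k′ = trans (cong (λ w → B k ++ suffix ∷ w) (blocks-∷ʳ B x xs k′))
                                  (sym (ListP.++-assoc (B k) (suffix ∷ blocks B (x ∷ xs)) _))

reverse-∷ : {A : Set} (x : A) (xs : List A) → ∃₂ λ y ys → reverse (x ∷ xs) ≡ y ∷ ys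
reverse-∷ x xs = split (reverse xs) (ListP.unfold-reverse x xs)
  where
  split : ∀ ys → reverse (x ∷ xs) ≡ ys ++ [ x ] → ∃₂ λ y ys′ → reverse (x ∷ xs) ≡ y ∷ ys′
  split []       eq = x , [] , eq
  split (y ∷ ys) eq = y , ys ++ [ x ] , eq

All-reverse : {A : Set} {P : A → Set} (xs : List A) → All P xs → All P (reverse xs)
All-reverse []       _          = All.[]
All-reverse (x ∷ xs) (px ∷ pxs) = subst (All _) (sym (ListP.unfold-reverse x xs)) (AllP.++⁺ (All-reverse xs pxs) (px ∷ All.[]))

reverseMap-blocks : ∀ {B B′} → (∀ k → reverseMap swapDiv (B k) ≡ B′ k) →
                    ∀ ks → reverseMap swapDiv (blocks B ks) ≡ blocks B′ (reverse ks)
reverseMap-blocks B≡ []            = refl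
reverseMap-blocks B≡ (k ∷ [])      = B≡ k
reverseMap-blocks {B} {B′} B≡ (k ∷ k′ ∷ ks) = step (reverse-∷ k′ ks) (reverseMap-blocks B≡ (k′ ∷ ks))
  where
  open ≡-Reasoning
  rest = blocks B (k′ ∷ ks)
  step : (∃₂ λ y ys → reverse (k′ ∷ ks) ≡ y ∷ ys) → reverseMap swapDiv rest ≡ blocks B′ (reverse (k′ ∷ ks)) →
         reverseMap swapDiv (blocks B (k ∷ k′ ∷ ks)) ≡ blocks B′ (reverse (k ∷ k′ ∷ ks))
  step (y , ys , rev≡) ih = begin
    reverseMap swapDiv (B k ++ suffix ∷ rest)                              ≡⟨ reverseMap-++ swapDiv (B k) (suffix ∷ rest) ⟩
    reverseMap swapDiv (suffix ∷ rest) ++ reverseMap swapDiv (B k)         ≡⟨ cong₂ _++_ (ListP.unfold-reverse suffix (map swapDiv rest)) (B≡ k) ⟩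
    (reverseMap swapDiv rest ++ [ suffix ]) ++ B′ k                        ≡⟨ ListP.++-assoc (reverseMap swapDiv rest) [ suffix ] (B′ k) ⟩
    reverseMap swapDiv rest ++ suffix ∷ B′ k                               ≡⟨ cong (_++ suffix ∷ B′ k) (trans ih (cong (blocks B′) rev≡)) ⟩
    blocks B′ (y ∷ ys) ++ suffix ∷ B′ k                                    ≡⟨ sym (blocks-∷ʳ B′ y ys k) ⟩
    blocks B′ (y ∷ ys ++ [ k ])                                            ≡⟨ cong (λ xs → blocks B′ (xs ++ [ k ])) (sym rev≡) ⟩
    blocks B′ (reverse (k′ ∷ ks) ++ [ k ])                                 ≡⟨ cong (blocks B′) (sym (ListP.unfold-reverse k (k′ ∷ ks))) ⟩
    blocks B′ (reverse (k ∷ k′ ∷ ks))                                      ∎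

module Limit (z : ℕ) where
  open Operators z

  limitVec : ℕ → List ℕ → Vector
  limitVec j []        = ⟦ yWord ^ʷ (j ∸ 1) ⟧* one
  limitVec j (j′ ∷ js) = ⟦ yWord ^ʷ (j ∸ 1) ⟧* (⟦ xWord ⟧* (limitVec j′ js))

  -- Φ (limitVec j js) m is the sum of the series G_{(j ∷ js)}(z) over m₁₁ ≥ m.
  Φ : Vector → ℕ → ℚ
  Φ c m = ∑[ n ∈ range 1 z ] (c n * inv (m +ₙ (n ∸ 1)))

  δ : ℕ → Vector
  δ m t = inv (m +ₙ (t ∸ 1)) - inv (suc m +ₙ (t ∸ 1))

  Φ-diff : ∀ c m → Φ c m - Φ c (suc m) ≡ ⟨ c , δ m ⟩
  Φ-diff c m = trans (sym (∑-- (range 1 z) _ _)) (∑-ext (range 1 z) (λ t →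
    solve 3 (λ x a b → x :* a :- x :* b := x :* (a :- b)) refl (c t) (inv (m +ₙ (t ∸ 1))) (inv (suc m +ₙ (t ∸ 1)))))

  ∑-δ : ∀ m a b → 1 ≤ a → a ≤ suc b → ∑ (range a b) (δ m) ≡ inv (m +ₙ (a ∸ 1)) - inv (m +ₙ b)
  ∑-δ m a b 1≤a a≤1+b =
    trans (∑-congᵣ a b (λ t a≤t _ → cong (λ k → inv (m +ₙ (t ∸ 1)) - inv k) (shift t (ℕP.≤-trans 1≤a a≤t))))
          (∑-telescope (λ t → inv (m +ₙ (t ∸ 1))) a b a≤1+b)
    where
    shift : ∀ t → 1 ≤ t → suc m +ₙ (t ∸ 1) ≡ m +ₙ (suc t ∸ 1)
    shift (suc t) _ = sym (ℕP.+-suc m t)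

  suffix-δ : ∀ m n → 1 ≤ n → n ≤ z → ⟦ suffix ⟧ (δ m) n ≡ inv (m +ₙ (n ∸ 1)) - inv (m +ₙ z)
  suffix-δ m n 1≤n n≤z = trans (∑-restrict-≥ z n (δ m) 1≤n (ℕP.m≤n⇒m≤1+n n≤z)) (∑-δ m n z 1≤n (ℕP.m≤n⇒m≤1+n n≤z))

  prefix-δ : ∀ m n → n ≤ z → ⟦ prefix ⟧ (δ m) n ≡ inv m - inv (m +ₙ n)
  prefix-δ m n n≤z = trans (∑-restrict-≤ z n (δ m) n≤z)
    (trans (∑-δ m 1 n (s≤s z≤n) (s≤s z≤n)) (cong (λ k → inv k - inv (m +ₙ n)) (ℕP.+-identityʳ m)))

  Φ-one-diff : ∀ m → Φ one m - Φ one (suc m) ≡ inv m - inv (m +ₙ z)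
  Φ-one-diff m = begin
    Φ one m - Φ one (suc m)                     ≡⟨ Φ-diff one m ⟩
    ∑[ t ∈ range 1 z ] (1ℚ * δ m t)             ≡⟨ ∑-ext (range 1 z) (λ t → ℚP.*-identityˡ (δ m t)) ⟩
    ∑ (range 1 z) (δ m)                         ≡⟨ ∑-δ m 1 z (s≤s z≤n) (s≤s z≤n) ⟩
    inv (m +ₙ 0) - inv (m +ₙ z)                 ≡⟨ cong (λ k → inv k - inv (m +ₙ z)) (ℕP.+-identityʳ m) ⟩
    inv m - inv (m +ₙ z)                        ∎
    where open ≡-Reasoning

  Φ-yWord-diff : ∀ c m → 1 ≤ m → Φ (⟦ yWord ⟧* c) m - Φ (⟦ yWord ⟧* c) (suc m) ≡ inv (m +ₙ z) * Φ c m
  Φ-yWord-diff c m 1≤m = begin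
    Φ (⟦ yWord ⟧* c) m - Φ (⟦ yWord ⟧* c) (suc m)
      ≡⟨ Φ-diff (⟦ yWord ⟧* c) m ⟩
    ⟨ ⟦ yWord ⟧* c , δ m ⟩
      ≡⟨ ⟨⟩-comm (⟦ yWord ⟧* c) (δ m) ⟩
    ⟨ δ m , ⟦ yWord ⟧* c ⟩
      ≡⟨ adjoint* yWord (δ m) c ⟩
    ∑[ n ∈ range 1 z ] ((inv (suc z ∸ n) * ⟦ suffix ⟧ (δ m) n) * c n)
      ≡⟨ ∑-congᵣ 1 z (λ n 1≤n n≤z → cong (_* c n) (trans (cong (inv (suc z ∸ n) *_) (suffix-δ m n 1≤n n≤z))
           (inv-partialFractions (suc z ∸ n) (m +ₙ (n ∸ 1)) (m +ₙ z) (ℕP.m<n⇒0<n∸m (s≤s n≤z))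
                                 (ℕP.≤-trans 1≤m (ℕP.m≤m+n m _)) (complement n 1≤n n≤z)))) ⟩
    ∑[ n ∈ range 1 z ] ((inv (m +ₙ (n ∸ 1)) * inv (m +ₙ z)) * c n)
      ≡⟨ ∑-ext (range 1 z) (λ n → solve 3 (λ p q c → (p :* q) :* c := q :* (c :* p)) refl (inv (m +ₙ (n ∸ 1))) (inv (m +ₙ z)) (c n)) ⟩
    ∑[ n ∈ range 1 z ] (inv (m +ₙ z) * (c n * inv (m +ₙ (n ∸ 1))))
      ≡⟨ ∑-*ˡ (range 1 z) (inv (m +ₙ z)) _ ⟩
    inv (m +ₙ z) * Φ c m
      ∎
    where
    open ≡-Reasoning
    complement : ∀ n → 1 ≤ n → n ≤ z → (suc z ∸ n) +ₙ (m +ₙ (n ∸ 1)) ≡ m +ₙ z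
    complement (suc n) _ n<z = begin
      (z ∸ n) +ₙ (m +ₙ n)   ≡⟨ sym (ℕP.+-assoc (z ∸ n) m n) ⟩
      (z ∸ n) +ₙ m +ₙ n     ≡⟨ cong (_+ₙ n) (ℕP.+-comm (z ∸ n) m) ⟩
      m +ₙ (z ∸ n) +ₙ n     ≡⟨ ℕP.+-assoc m (z ∸ n) n ⟩
      m +ₙ ((z ∸ n) +ₙ n)   ≡⟨ cong (m +ₙ_) (ℕP.m∸n+n≡m (ℕP.≤-trans (ℕP.n≤1+n n) n<z)) ⟩
      m +ₙ z                ∎

  Φ-xWord-diff : ∀ c m → 1 ≤ m → Φ (⟦ xWord ⟧* c) m - Φ (⟦ xWord ⟧* c) (suc m) ≡ inv m * Φ c (suc m)
  Φ-xWord-diff c m 1≤m = begin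
    Φ (⟦ xWord ⟧* c) m - Φ (⟦ xWord ⟧* c) (suc m)
      ≡⟨ Φ-diff (⟦ xWord ⟧* c) m ⟩
    ⟨ ⟦ xWord ⟧* c , δ m ⟩
      ≡⟨ ⟨⟩-comm (⟦ xWord ⟧* c) (δ m) ⟩
    ⟨ δ m , ⟦ xWord ⟧* c ⟩
      ≡⟨ adjoint* xWord (δ m) c ⟩
    ∑[ n ∈ range 1 z ] ((inv n * ⟦ prefix ⟧ (δ m) n) * c n)
      ≡⟨ ∑-congᵣ 1 z (λ n 1≤n n≤z → cong (_* c n) (trans (cong (inv n *_) (prefix-δ m n n≤z))
           (inv-partialFractions n m (m +ₙ n) 1≤n 1≤m (ℕP.+-comm n m)))) ⟩
    ∑[ n ∈ range 1 z ] ((inv m * inv (m +ₙ n)) * c n)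
      ≡⟨ ∑-congᵣ 1 z (λ n 1≤n _ → trans (solve 3 (λ p q c → (p :* q) :* c := p :* (c :* q)) refl (inv m) (inv (m +ₙ n)) (c n))
                                       (cong (λ k → inv m * (c n * inv k)) (shift n 1≤n))) ⟩
    ∑[ n ∈ range 1 z ] (inv m * (c n * inv (suc m +ₙ (n ∸ 1))))
      ≡⟨ ∑-*ˡ (range 1 z) (inv m) _ ⟩
    inv m * Φ c (suc m)
      ∎
    where
    open ≡-Reasoning
    shift : ∀ n → 1 ≤ n → m +ₙ n ≡ suc m +ₙ (n ∸ 1)
    shift (suc n) _ = ℕP.+-suc m n

  NonNegative : Vector → Set
  NonNegative v = ∀ n → 1 ≤ n → n ≤ z → 0ℚ ≤ℚ v n

  ⟦⟧-nonNeg : ∀ o {v} → NonNegative v → NonNegative (⟦ o ⟧ v)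
  ⟦⟧-nonNeg prefix     0≤v t _ _ = ∑-nonNegᵣ 1 z (λ m 1≤m m≤z → 0≤when _ (0≤v m 1≤m m≤z))
  ⟦⟧-nonNeg suffix     0≤v t _ _ = ∑-nonNegᵣ 1 z (λ m 1≤m m≤z → 0≤when _ (0≤v m 1≤m m≤z))
  ⟦⟧-nonNeg divIndex   0≤v n 1≤n n≤z = *-nonNeg (0≤inv n) (0≤v n 1≤n n≤z)
  ⟦⟧-nonNeg divCoindex 0≤v n 1≤n n≤z = *-nonNeg (0≤inv (suc z ∸ n)) (0≤v n 1≤n n≤z)

  ⟦⟧*-nonNeg : ∀ w {v} → NonNegative v → NonNegative (⟦ w ⟧* v)
  ⟦⟧*-nonNeg []      0≤v = 0≤v
  ⟦⟧*-nonNeg (o ∷ w) 0≤v = ⟦⟧-nonNeg o (⟦⟧*-nonNeg w 0≤v)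

  one-nonNeg : NonNegative one
  one-nonNeg _ _ _ = ℚP.nonNegative⁻¹ 1ℚ

  limitVec-nonNeg : ∀ j js → NonNegative (limitVec j js)
  limitVec-nonNeg j []        = ⟦⟧*-nonNeg (yWord ^ʷ (j ∸ 1)) one-nonNeg
  limitVec-nonNeg j (j′ ∷ js) = ⟦⟧*-nonNeg (yWord ^ʷ (j ∸ 1)) (⟦⟧*-nonNeg xWord (limitVec-nonNeg j′ js))

  total : Vector → ℚ
  total v = ∑ (range 1 z) v

  0≤total : ∀ {v} → NonNegative v → 0ℚ ≤ℚ total v
  0≤total 0≤v = ∑-nonNegᵣ 1 z 0≤v

  0≤Φ : ∀ {c} m → NonNegative c → 0ℚ ≤ℚ Φ c m
  0≤Φ m 0≤c = ∑-nonNegᵣ 1 z (λ n 1≤n n≤z → *-nonNeg (0≤c n 1≤n n≤z) (0≤inv (m +ₙ (n ∸ 1))))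

  Φ≤inv*total : ∀ {c} m → NonNegative c → 1 ≤ m → Φ c m ≤ℚ inv m * total c
  Φ≤inv*total {c} m 0≤c 1≤m =
    ℚP.≤-trans (∑-monoᵣ 1 z (λ n 1≤n n≤z → *-monoˡ-≤ (0≤c n 1≤n n≤z) (inv-antimono-≤ 1≤m (ℕP.m≤m+n m (n ∸ 1)))))
               (ℚP.≤-reflexive (trans (∑-ext (range 1 z) (λ n → ℚP.*-comm (c n) (inv m))) (∑-*ˡ (range 1 z) (inv m) c)))

  -- totals j js bounds the total of every intermediate vector in the construction of limitVec j js.
  totalsLast : ℕ → ℚ
  totalsLast zero    = 0ℚ
  totalsLast (suc j) = total (⟦ yWord ^ʷ j ⟧* one) + totalsLast j

  totalsMid : ℕ → Vector → ℚ
  totalsMid zero    c = 0ℚ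
  totalsMid (suc j) c = total (⟦ yWord ^ʷ j ⟧* (⟦ xWord ⟧* c)) + totalsMid j c

  totals : ℕ → List ℕ → ℚ
  totals j []        = totalsLast j
  totals j (j′ ∷ js) = totalsMid j (limitVec j′ js) + totals j′ js

  0≤totalsLast : ∀ j → 0ℚ ≤ℚ totalsLast j
  0≤totalsLast zero    = ℚP.≤-refl
  0≤totalsLast (suc j) = +-nonNeg (0≤total (⟦⟧*-nonNeg (yWord ^ʷ j) one-nonNeg)) (0≤totalsLast j)

  0≤totalsMid : ∀ j {c} → NonNegative c → 0ℚ ≤ℚ totalsMid j c
  0≤totalsMid zero    0≤c = ℚP.≤-refl
  0≤totalsMid (suc j) 0≤c = +-nonNeg (0≤total (⟦⟧*-nonNeg (yWord ^ʷ j) (⟦⟧*-nonNeg xWord 0≤c))) (0≤totalsMid j 0≤c)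

  0≤totals : ∀ j js → 0ℚ ≤ℚ totals j js
  0≤totals j []        = 0≤totalsLast j
  0≤totals j (j′ ∷ js) = +-nonNeg (0≤totalsMid j (limitVec-nonNeg j′ js)) (0≤totals j′ js)

module ZetaIdentity (z : ℕ) where
  open Operators z
  open Limit z

  χ≥ : ℕ → Vector
  χ≥ β m = when (does (β ≤? m)) 1ℚ

  chainSum : ℕ → ℕ → ℕ → ℚ
  chainSum j n β = ∑[ ns ∈ wchains j n z ] when (does (β ≤? lastOr n ns)) (prodℚ (map inv ns))

  chainSum-suc : ∀ j n β → chainSum (suc j) n β ≡ ∑[ m ∈ range n z ] (inv m * chainSum j m β)
  chainSum-suc j n β =
    trans (∑-concatMap (λ m → map (m ∷_) (wchains j m z)) (range n z) _)
    (∑-ext (range n z) (λ m → trans (∑-map (m ∷_) (wchains j m z) _)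
      (trans (∑-ext (wchains j m z) (λ ns → sym (when-*ˡ (does (β ≤? lastOr m ns)) (inv m) _)))
             (∑-*ˡ (wchains j m z) (inv m) _))))

  chainSum≡⟦xWord^⟧ : ∀ j n β → 1 ≤ n → n ≤ z → chainSum j n β ≡ ⟦ xWord ^ʷ j ⟧* (χ≥ β) n
  chainSum≡⟦xWord^⟧ zero    n β _   _   = ℚP.+-identityʳ _
  chainSum≡⟦xWord^⟧ (suc j) n β 1≤n n≤z = begin
    chainSum (suc j) n β                                         ≡⟨ chainSum-suc j n β ⟩
    ∑[ m ∈ range n z ] (inv m * chainSum j m β)                  ≡⟨ ∑-congᵣ n z (λ m n≤m m≤z → cong (inv m *_) (chainSum≡⟦xWord^⟧ j m β (ℕP.≤-trans 1≤n n≤m) m≤z)) ⟩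
    ∑[ m ∈ range n z ] ⟦ divIndex ⟧ W m                          ≡⟨ sym (∑-restrict-≥ z n (⟦ divIndex ⟧ W) 1≤n (ℕP.m≤n⇒m≤1+n n≤z)) ⟩
    ⟦ suffix ⟧ (⟦ divIndex ⟧ W) n                                ∎
    where
    open ≡-Reasoning
    W = ⟦ xWord ^ʷ j ⟧* (χ≥ β)

  ⟨v,χ≥⟩ : ∀ v β → ⟨ v , χ≥ β ⟩ ≡ ⟦ suffix ⟧ v β
  ⟨v,χ≥⟩ v β = ∑-ext (range 1 z) (λ m → trans (when-*ˡ (does (β ≤? m)) (v m) 1ℚ) (cong (when _) (ℚP.*-identityʳ (v m))))

  -- The chain n ≤ n₂ ≤ ⋯ ≤ n_{j+1} of a block is summed from its last variable, giving ⟦ xWord ^ʷ j ⟧* (χ≥ β);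
  -- adjointness moves this word onto the weight of the first variable, where it becomes ζBlock.
  zsum-cons : ∀ j ks β → zsum (suc z) (suc j ∷ ks) β ≡ ⟦ suffix ⟧ (⟦ ζBlock (suc j) ⟧* (zsum (suc z) ks)) β
  zsum-cons j ks β = begin
    zsum (suc z) (suc j ∷ ks) β
      ≡⟨ ∑-filter (λ b → β ≤? lastOr 0 b) (wchains (suc j) 1 z) F ⟩
    ∑[ b ∈ wchains (suc j) 1 z ] when (does (β ≤? lastOr 0 b)) (F b)
      ≡⟨ ∑-concatMap (λ n → map (n ∷_) (wchains j n z)) (range 1 z) _ ⟩
    ∑[ n ∈ range 1 z ] ∑ (map (n ∷_) (wchains j n z)) (λ b → when (does (β ≤? lastOr 0 b)) (F b))
      ≡⟨ ∑-ext (range 1 z) (λ n → trans (∑-map (n ∷_) (wchains j n z) _) (factor n)) ⟩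
    ⟨ ⟦ divCoindex ⟧ h , (λ n → chainSum j n β) ⟩
      ≡⟨ ⟨⟩-cong {⟦ divCoindex ⟧ h} (λ _ _ _ → refl) (λ n → chainSum≡⟦xWord^⟧ j n β) ⟩
    ⟨ ⟦ divCoindex ⟧ h , ⟦ xWord ^ʷ j ⟧* (χ≥ β) ⟩
      ≡⟨ adjoint* (xWord ^ʷ j) _ _ ⟩
    ⟨ ⟦ reverseMap transpose (xWord ^ʷ j) ⟧* (⟦ divCoindex ⟧ h) , χ≥ β ⟩
      ≡⟨ cong (λ w → ⟨ ⟦ w ⟧* (⟦ divCoindex ⟧ h) , χ≥ β ⟩) (reverseMap-^ʷ transpose xWord j) ⟩
    ⟨ ⟦ xᵀWord ^ʷ j ⟧* (⟦ divCoindex ⟧ h) , χ≥ β ⟩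
      ≡⟨ ⟨v,χ≥⟩ _ β ⟩
    ⟦ suffix ⟧ (⟦ xᵀWord ^ʷ j ⟧* (⟦ divCoindex ⟧ h)) β
      ≡⟨ cong (λ v → ⟦ suffix ⟧ v β) (sym (⟦⟧*-++ (xᵀWord ^ʷ j) [ divCoindex ] h)) ⟩
    ⟦ suffix ⟧ (⟦ ζBlock (suc j) ⟧* h) β
      ∎
    where
    open ≡-Reasoning
    h = zsum (suc z) ks
    F : List ℕ → ℚ
    F b = zBlock (suc z) b * h (headOr 0 b)
    pull : ∀ b a p c → when b ((a * p) * c) ≡ (a * c) * when b p
    pull true  a p c = solve 3 (λ a p c → (a :* p) :* c := (a :* c) :* p) refl a p c
    pull false a p c = sym (ℚP.*-zeroʳ (a * c))
    factor : ∀ n → ∑[ ns ∈ wchains j n z ] when (does (β ≤? lastOr n ns)) ((inv (suc z ∸ n) * prodℚ (map inv ns)) * h n)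
                   ≡ ⟦ divCoindex ⟧ h n * chainSum j n β
    factor n = trans (∑-ext (wchains j n z) (λ ns → pull _ (inv (suc z ∸ n)) _ (h n)))
                     (∑-*ˡ (wchains j n z) (⟦ divCoindex ⟧ h n) (λ ns → when (does (β ≤? lastOr n ns)) (prodℚ (map inv ns))))

  zsum≡⟦blocks⟧ : ∀ k ks → All (1 ≤_) (k ∷ ks) → ∀ β →
                  zsum (suc z) (k ∷ ks) β ≡ ⟦ suffix ⟧ (⟦ blocks ζBlock (k ∷ ks) ⟧* one) β
  zsum≡⟦blocks⟧ zero    _         (() ∷ _)     β
  zsum≡⟦blocks⟧ (suc j) []        _            β = zsum-cons j [] β
  zsum≡⟦blocks⟧ (suc j) (k′ ∷ ks) (_ ∷ 1≤k′∷ks) β = begin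
    zsum (suc z) (suc j ∷ k′ ∷ ks) β
      ≡⟨ zsum-cons j (k′ ∷ ks) β ⟩
    ⟦ suffix ⟧ (⟦ ζBlock (suc j) ⟧* (zsum (suc z) (k′ ∷ ks))) β
      ≡⟨ suffix-cong (⟦⟧*-cong (ζBlock (suc j)) (λ n _ _ → zsum≡⟦blocks⟧ k′ ks 1≤k′∷ks n)) β ⟩
    ⟦ suffix ⟧ (⟦ ζBlock (suc j) ⟧* (⟦ suffix ∷ blocks ζBlock (k′ ∷ ks) ⟧* one)) β
      ≡⟨ cong (λ v → ⟦ suffix ⟧ v β) (sym (⟦⟧*-++ (ζBlock (suc j)) (suffix ∷ blocks ζBlock (k′ ∷ ks)) one)) ⟩
    ⟦ suffix ⟧ (⟦ blocks ζBlock (suc j ∷ k′ ∷ ks) ⟧* one) β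
      ∎
    where open ≡-Reasoning

  zetaStarFlat<≡value : ∀ k ks → All (1 ≤_) (k ∷ ks) → zetaStarFlat< (suc z) (k ∷ ks) ≡ value (blocks ζBlock (k ∷ ks))
  zetaStarFlat<≡value k ks 1≤k∷ks = trans (zsum≡⟦blocks⟧ k ks 1≤k∷ks 0)
    (∑-ext (range 1 z) (λ m → trans (when-≤-yes {0} {m} (⟦ blocks ζBlock (k ∷ ks) ⟧* one m) z≤n) (sym (ℚP.*-identityˡ _))))

  divIndex-limitVec : ∀ j js → ⟦ divIndex ⟧ (limitVec j js) ≡ ⟦ blocks GBlock (j ∷ js) ⟧* one
  divIndex-limitVec j []        = refl
  divIndex-limitVec j (j′ ∷ js) = begin
    ⟦ GBlock j ⟧* (⟦ suffix ⟧ (⟦ divIndex ⟧ (limitVec j′ js)))   ≡⟨ cong (λ v → ⟦ GBlock j ⟧* (⟦ suffix ⟧ v)) (divIndex-limitVec j′ js) ⟩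
    ⟦ GBlock j ⟧* (⟦ suffix ∷ blocks GBlock (j′ ∷ js) ⟧* one)        ≡⟨ sym (⟦⟧*-++ (GBlock j) (suffix ∷ blocks GBlock (j′ ∷ js)) one) ⟩
    ⟦ blocks GBlock (j ∷ j′ ∷ js) ⟧* one                             ∎
    where open ≡-Reasoning

  Φ-at-1 : ∀ c → Φ c 1 ≡ ⟨ one , ⟦ divIndex ⟧ c ⟩
  Φ-at-1 c = ∑-congᵣ 1 z (λ n 1≤n _ → trans (cong (λ k → c n * inv k) (ℕP.m+[n∸m]≡n 1≤n))
                                           (trans (ℚP.*-comm (c n) (inv n)) (sym (ℚP.*-identityˡ _))))

  zetaStarFlat<≡Φ : ∀ k ks y ys → All (1 ≤_) (k ∷ ks) → reverse (k ∷ ks) ≡ y ∷ ys →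
                    zetaStarFlat< (suc z) (k ∷ ks) ≡ Φ (limitVec y ys) 1
  zetaStarFlat<≡Φ k ks y ys 1≤k∷ks rev≡ = begin
    zetaStarFlat< (suc z) (k ∷ ks)                                       ≡⟨ zetaStarFlat<≡value k ks 1≤k∷ks ⟩
    value (blocks ζBlock (k ∷ ks))                                       ≡⟨ cong (value ∘ blocks ζBlock) (sym (ListP.reverse-involutive (k ∷ ks))) ⟩
    value (blocks ζBlock (reverse (reverse (k ∷ ks))))                   ≡⟨ cong value (sym (reverseMap-blocks reverseMap-GBlock (reverse (k ∷ ks)))) ⟩
    value (reverseMap swapDiv (blocks GBlock (reverse (k ∷ ks))))        ≡⟨ sym (value-reverseMap-swapDiv (blocks GBlock (reverse (k ∷ ks)))) ⟩
    value (blocks GBlock (reverse (k ∷ ks)))                             ≡⟨ cong (value ∘ blocks GBlock) rev≡ ⟩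
    value (blocks GBlock (y ∷ ys))                                       ≡⟨ cong (⟨ one ,_⟩) (sym (divIndex-limitVec y ys)) ⟩
    ⟨ one , ⟦ divIndex ⟧ (limitVec y ys) ⟩                               ≡⟨ sym (Φ-at-1 (limitVec y ys)) ⟩
    Φ (limitVec y ys) 1                                                  ∎
    where open ≡-Reasoning

module PartialSums (z M : ℕ) where

  stepLast : ℕ → ℚ
  stepLast lo = ∑[ m ∈ range lo M ] (inv m - inv (m +ₙ z))

  stepWithin : (ℕ → ℚ) → ℕ → ℚ
  stepWithin g lo = ∑[ m ∈ range lo M ] (inv (m +ₙ z) * g m)

  stepAcross : (ℕ → ℚ) → ℕ → ℚ
  stepAcross g lo = ∑[ m ∈ range lo M ] (inv m * g (suc m))

  lastBlockSum : ℕ → ℕ → ℚ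
  lastBlockSum zero          = λ _ → 0ℚ
  lastBlockSum (suc zero)    = stepLast
  lastBlockSum (suc (suc j)) = stepWithin (lastBlockSum (suc j))

  midBlockSum : ℕ → (ℕ → ℚ) → ℕ → ℚ
  midBlockSum zero          g = λ _ → 0ℚ
  midBlockSum (suc zero)    g = stepAcross g
  midBlockSum (suc (suc j)) g = stepWithin (midBlockSum (suc j) g)

  partialSum : List ℕ → ℕ → ℚ
  partialSum []            = λ _ → 1ℚ
  partialSum (j ∷ [])      = lastBlockSum j
  partialSum (j ∷ j′ ∷ js) = midBlockSum j (partialSum (j′ ∷ js))

  ∑-wchains-suc : ∀ i lo (F : List ℕ → ℚ) →
                  ∑ (wchains (suc i) lo M) F ≡ ∑[ m ∈ range lo M ] ∑[ r ∈ wchains i m M ] F (m ∷ r)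
  ∑-wchains-suc i lo F = trans (∑-concatMap (λ m → map (m ∷_) (wchains i m M)) (range lo M) F)
                               (∑-ext (range lo M) (λ m → ∑-map (m ∷_) (wchains i m M) F))

  ∑-wchains-factor : ∀ i lo c (F G : List ℕ → ℚ) → (∀ m r → F (m ∷ r) ≡ c * G (m ∷ r)) →
                     ∑ (wchains (suc i) lo M) F ≡ c * ∑ (wchains (suc i) lo M) G
  ∑-wchains-factor i lo c F G F≡cG = begin
    ∑ (wchains (suc i) lo M) F                                     ≡⟨ ∑-wchains-suc i lo F ⟩
    ∑[ m ∈ range lo M ] ∑[ r ∈ wchains i m M ] F (m ∷ r)           ≡⟨ ∑-ext (range lo M) (λ m → trans (∑-ext (wchains i m M) (F≡cG m)) (∑-*ˡ (wchains i m M) c _)) ⟩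
    ∑[ m ∈ range lo M ] (c * ∑[ r ∈ wchains i m M ] G (m ∷ r))     ≡⟨ ∑-*ˡ (range lo M) c _ ⟩
    c * ∑[ m ∈ range lo M ] ∑[ r ∈ wchains i m M ] G (m ∷ r)       ≡⟨ cong (c *_) (sym (∑-wchains-suc i lo G)) ⟩
    c * ∑ (wchains (suc i) lo M) G                                 ∎
    where open ≡-Reasoning

  ∑-lastBlock : ∀ j lo → ∑ (wchains (suc j) lo M) (lastBlock z) ≡ lastBlockSum (suc j) lo
  ∑-lastBlock zero    lo = trans (∑-wchains-suc 0 lo (lastBlock z)) (∑-ext (range lo M) (λ m → ℚP.+-identityʳ _))
  ∑-lastBlock (suc i) lo = trans (∑-wchains-suc (suc i) lo (lastBlock z)) (∑-ext (range lo M) (λ m →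
    trans (∑-wchains-factor i m (inv (m +ₙ z)) (λ r → lastBlock z (m ∷ r)) (lastBlock z) (λ _ _ → refl))
          (cong (inv (m +ₙ z) *_) (∑-lastBlock i m))))

  ∑-midBlock : ∀ j (g : ℕ → ℚ) lo →
               ∑[ b ∈ wchains (suc j) lo M ] (midBlock z b * g (suc (lastOr lo b))) ≡ midBlockSum (suc j) g lo
  ∑-midBlock zero    g lo = trans (∑-wchains-suc 0 lo _) (∑-ext (range lo M) (λ m → ℚP.+-identityʳ _))
  ∑-midBlock (suc i) g lo = trans (∑-wchains-suc (suc i) lo _) (∑-ext (range lo M) (λ m →
    trans (∑-wchains-factor i m (inv (m +ₙ z)) _ (λ b → midBlock z b * g (suc (lastOr m b)))
                            (λ m′ r → ℚP.*-assoc (inv (m +ₙ z)) (midBlock z (m′ ∷ r)) _))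
          (cong (inv (m +ₙ z) *_) (∑-midBlock i g m))))

  ∑-gBlocks-factor : ∀ j js lo c (F G : List (List ℕ) → ℚ) → (∀ b r → F (b ∷ r) ≡ c * G (b ∷ r)) →
                     ∑ (gBlocks (j ∷ js) lo M) F ≡ c * ∑ (gBlocks (j ∷ js) lo M) G
  ∑-gBlocks-factor j js lo c F G F≡cG = begin
    ∑ (concatMap (λ b → map (b ∷_) (rest b)) (wchains j lo M)) F          ≡⟨ ∑-concatMap (λ b → map (b ∷_) (rest b)) (wchains j lo M) F ⟩
    ∑[ b ∈ wchains j lo M ] ∑ (map (b ∷_) (rest b)) F                     ≡⟨ ∑-ext (wchains j lo M) factor ⟩
    ∑[ b ∈ wchains j lo M ] (c * ∑ (map (b ∷_) (rest b)) G)               ≡⟨ ∑-*ˡ (wchains j lo M) c _ ⟩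
    c * ∑[ b ∈ wchains j lo M ] ∑ (map (b ∷_) (rest b)) G                 ≡⟨ cong (c *_) (sym (∑-concatMap (λ b → map (b ∷_) (rest b)) (wchains j lo M) G)) ⟩
    c * ∑ (concatMap (λ b → map (b ∷_) (rest b)) (wchains j lo M)) G      ∎
    where
    open ≡-Reasoning
    rest : List ℕ → List (List (List ℕ))
    rest b = gBlocks js (suc (lastOr lo b)) M
    factor : ∀ b → ∑ (map (b ∷_) (rest b)) F ≡ c * ∑ (map (b ∷_) (rest b)) G
    factor b = trans (∑-map (b ∷_) (rest b) F) (trans (∑-ext (rest b) (F≡cG b))
                 (trans (∑-*ˡ (rest b) c _) (cong (c *_) (sym (∑-map (b ∷_) (rest b) G)))))

  ∑gTerm≡partialSum : ∀ l → All (1 ≤_) l → ∀ lo → ∑ (gBlocks l lo M) (gTerm z) ≡ partialSum l lo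
  ∑gTerm≡partialSum []             _                lo = ℚP.+-identityʳ 1ℚ
  ∑gTerm≡partialSum (zero ∷ _)     (() ∷ _)         lo
  ∑gTerm≡partialSum (suc i ∷ [])   _                lo =
    trans (∑-concatMap (λ b → map (b ∷_) (gBlocks [] (suc (lastOr lo b)) M)) (wchains (suc i) lo M) (gTerm z))
          (trans (∑-ext (wchains (suc i) lo M) (λ b → ℚP.+-identityʳ _)) (∑-lastBlock i lo))
  ∑gTerm≡partialSum (suc i ∷ j′ ∷ js) (_ ∷ 1≤j′∷js) lo =
    trans (∑-concatMap (λ b → map (b ∷_) (rest b)) (wchains (suc i) lo M) (gTerm z))
          (trans (∑-ext (wchains (suc i) lo M) block) (∑-midBlock i (partialSum (j′ ∷ js)) lo))
    where
    rest : List ℕ → List (List (List ℕ))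
    rest b = gBlocks (j′ ∷ js) (suc (lastOr lo b)) M
    block : ∀ b → ∑ (map (b ∷_) (rest b)) (gTerm z) ≡ midBlock z b * partialSum (j′ ∷ js) (suc (lastOr lo b))
    block b = trans (∑-map (b ∷_) (rest b) (gTerm z))
      (trans (∑-gBlocks-factor j′ js (suc (lastOr lo b)) (midBlock z b) (λ r → gTerm z (b ∷ r)) (gTerm z) (λ _ _ → refl))
             (cong (midBlock z b *_) (∑gTerm≡partialSum (j′ ∷ js) 1≤j′∷js (suc (lastOr lo b)))))

0≤^ : ∀ {x} p → 0ℚ ≤ℚ x → 0ℚ ≤ℚ x ^ p
0≤^ zero    0≤x = ℚP.nonNegative⁻¹ 1ℚ
0≤^ (suc p) 0≤x = *-nonNeg 0≤x (0≤^ p 0≤x)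

1≤^ : ∀ {x} p → 1ℚ ≤ℚ x → 1ℚ ≤ℚ x ^ p
1≤^ zero    1≤x = ℚP.≤-refl
1≤^ (suc p) 1≤x = 1≤* 1≤x (1≤^ p 1≤x)

1^n≡1 : ∀ n → 1ℚ ^ n ≡ 1ℚ
1^n≡1 zero    = refl
1^n≡1 (suc n) = trans (cong (1ℚ *_) (1^n≡1 n)) (ℚP.*-identityˡ 1ℚ)

^-mono-≤ : ∀ {u v} p → 0ℚ ≤ℚ u → u ≤ℚ v → u ^ p ≤ℚ v ^ p
^-mono-≤ zero    0≤u u≤v = ℚP.≤-refl
^-mono-≤ (suc p) 0≤u u≤v = ℚP.≤-trans (*-monoʳ-≤ (0≤^ p 0≤u) u≤v) (*-monoˡ-≤ (ℚP.≤-trans 0≤u u≤v) (^-mono-≤ p 0≤u u≤v))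

^-suc-≤ : ∀ {u v} p → 0ℚ ≤ℚ u → u ≤ℚ v → v ^ suc p ≤ℚ u ^ suc p + fromℕ (suc p) * v ^ p * (v - u)
^-suc-≤ {u} {v} zero    _   _   = ℚP.≤-reflexive
  (solve 2 (λ u v → v :* con 1ℚ := u :* con 1ℚ :+ (con 1ℚ :+ con 0ℚ) :* con 1ℚ :* (v :- u)) refl u v)
^-suc-≤ {u} {v} (suc p) 0≤u u≤v = begin
  v * v ^ suc p
    ≤⟨ *-monoˡ-≤ (ℚP.≤-trans 0≤u u≤v) (^-suc-≤ p 0≤u u≤v) ⟩
  v * (U + n * v ^ p * (v - u))
    ≡⟨ solve 5 (λ u v U V n → v :* (U :+ n :* V :* (v :- u)) := u :* U :+ (v :- u) :* U :+ n :* (v :* V) :* (v :- u)) refl u v U (v ^ p) n ⟩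
  u * U + (v - u) * U + n * (v * v ^ p) * (v - u)
    ≤⟨ ℚP.+-monoˡ-≤ _ (ℚP.+-monoʳ-≤ (u * U) (*-monoˡ-≤ (p≤q⇒0≤q-p u≤v) (^-mono-≤ (suc p) 0≤u u≤v))) ⟩
  u * U + (v - u) * v ^ suc p + n * (v * v ^ p) * (v - u)
    ≡⟨ solve 4 (λ A d W n → A :+ d :* W :+ n :* W :* d := A :+ (con 1ℚ :+ n) :* W :* d) refl (u * U) (v - u) (v ^ suc p) n ⟩
  u * U + fromℕ (suc (suc p)) * v ^ suc p * (v - u)
    ∎
  where
  open ℚP.≤-Reasoning
  U = u ^ suc p
  n = fromℕ (suc p)

harmonic : ℕ → ℚ
harmonic M = ∑ (range 1 M) inv

0≤harmonic : ∀ M → 0ℚ ≤ℚ harmonic M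
0≤harmonic M = ∑-nonNegᵣ 1 M (λ n _ _ → 0≤inv n)

∑inv≤harmonic : ∀ lo M → 1 ≤ lo → lo ≤ suc M → ∑ (range lo M) inv ≤ℚ harmonic M
∑inv≤harmonic (suc lo) M _ lo<1+M = begin
  ∑ (range (suc lo) M) inv                               ≤⟨ ℚP.≤-trans (ℚP.≤-reflexive (sym (ℚP.+-identityˡ _))) (ℚP.+-monoˡ-≤ _ (∑-nonNegᵣ 1 lo (λ n _ _ → 0≤inv n))) ⟩
  ∑ (range 1 lo) inv + ∑ (range (suc lo) M) inv          ≡⟨ sym (∑-split 1 lo M inv (s≤s z≤n) (ℕP.≤-pred lo<1+M)) ⟩
  harmonic M                                             ∎
  where open ℚP.≤-Reasoning

-- Chosen so that the induction step of (1 + harmonic M) ^ p ≤ growth p · (M + 1) closes.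
growth : ℕ → ℕ
growth zero    = 1
growth (suc p) = suc (2 *ₙ (suc p *ₙ growth p))

harmonic-suc : ∀ M → harmonic (suc M) ≡ harmonic M + inv (suc M)
harmonic-suc M = ∑-snoc 1 M inv (s≤s z≤n)

1+harmonic^≤ : ∀ p M → (1ℚ + harmonic M) ^ p ≤ℚ fromℕ (growth p) * fromℕ (suc M)
1+harmonic^≤ zero    M       = 1≤* (1≤fromℕ-suc 0) (1≤fromℕ-suc M)
1+harmonic^≤ (suc p) zero    = ℚP.≤-trans (ℚP.≤-reflexive (trans (cong (_^ suc p) (ℚP.+-identityʳ 1ℚ)) (1^n≡1 (suc p))))
                                           (1≤* (1≤fromℕ-suc (2 *ₙ (suc p *ₙ growth p))) (1≤fromℕ-suc 0))
1+harmonic^≤ (suc p) (suc M) = begin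
  v ^ suc p
    ≤⟨ ^-suc-≤ p 0≤u u≤v ⟩
  u ^ suc p + fromℕ (suc p) * v ^ p * (v - u)
    ≡⟨ cong (λ w → u ^ suc p + fromℕ (suc p) * v ^ p * w) v-u ⟩
  u ^ suc p + fromℕ (suc p) * v ^ p * inv (suc M)
    ≤⟨ ℚP.+-mono-≤ (1+harmonic^≤ (suc p) M) (*-monoʳ-≤ (0≤inv (suc M)) (*-monoˡ-≤ (0≤fromℕ (suc p)) (1+harmonic^≤ p (suc M)))) ⟩
  C′ * fromℕ (suc M) + fromℕ (suc p) * (fromℕ (growth p) * fromℕ (suc (suc M))) * inv (suc M)
    ≡⟨ solve 5 (λ C n c s i → C :* s :+ n :* (c :* (con 1ℚ :+ s)) :* i := C :* s :+ (n :* c) :* (i :+ s :* i))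
               refl C′ (fromℕ (suc p)) (fromℕ (growth p)) (fromℕ (suc M)) (inv (suc M)) ⟩
  C′ * fromℕ (suc M) + B * (inv (suc M) + fromℕ (suc M) * inv (suc M))
    ≡⟨ cong (λ w → C′ * fromℕ (suc M) + B * (inv (suc M) + w)) (fromℕ*inv≡1 M) ⟩
  C′ * fromℕ (suc M) + B * (inv (suc M) + 1ℚ)
    ≤⟨ ℚP.+-monoʳ-≤ (C′ * fromℕ (suc M)) (*-monoˡ-≤ 0≤B (ℚP.+-monoˡ-≤ 1ℚ (inv≤1 M))) ⟩
  C′ * fromℕ (suc M) + B * (1ℚ + 1ℚ)
    ≤⟨ ℚP.+-monoʳ-≤ (C′ * fromℕ (suc M)) 2B≤C′ ⟩
  C′ * fromℕ (suc M) + C′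
    ≡⟨ solve 2 (λ C s → C :* s :+ C := C :* (con 1ℚ :+ s)) refl C′ (fromℕ (suc M)) ⟩
  C′ * fromℕ (suc (suc M))
    ∎
  where
  open ℚP.≤-Reasoning
  u = 1ℚ + harmonic M
  v = 1ℚ + harmonic (suc M)
  C′ = fromℕ (growth (suc p))
  B = fromℕ (suc p) * fromℕ (growth p)
  0≤B : 0ℚ ≤ℚ B
  0≤B = *-nonNeg (0≤fromℕ (suc p)) (0≤fromℕ (growth p))
  0≤u : 0ℚ ≤ℚ u
  0≤u = +-nonNeg (ℚP.nonNegative⁻¹ 1ℚ) (0≤harmonic M)
  v≡u+inv : v ≡ u + inv (suc M)
  v≡u+inv = trans (cong (1ℚ +_) (harmonic-suc M)) (sym (ℚP.+-assoc 1ℚ (harmonic M) (inv (suc M))))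
  v-u : v - u ≡ inv (suc M)
  v-u = trans (cong (_- u) v≡u+inv) (solve 2 (λ u i → u :+ i :- u := i) refl u (inv (suc M)))
  u≤v : u ≤ℚ v
  u≤v = ℚP.≤-trans (p≤p+q u (0≤inv (suc M))) (ℚP.≤-reflexive (sym v≡u+inv))
  2B≤C′ : B * (1ℚ + 1ℚ) ≤ℚ C′
  2B≤C′ = ℚP.≤-trans (ℚP.≤-trans (ℚP.≤-reflexive (sym (ℚP.+-identityˡ (B * (1ℚ + 1ℚ))))) (ℚP.+-monoˡ-≤ (B * (1ℚ + 1ℚ)) (ℚP.nonNegative⁻¹ 1ℚ)))
    (ℚP.≤-reflexive (cong (1ℚ +_) (trans (solve 1 (λ b → b :* (con 1ℚ :+ con 1ℚ) := (con 1ℚ :+ (con 1ℚ :+ con 0ℚ)) :* b) refl B)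
                                         (sym (trans (fromℕ-* 2 (suc p *ₙ growth p)) (cong (fromℕ 2 *_) (fromℕ-* (suc p) (growth p))))))))

module TailEstimate (M : ℕ) where

  WithinError : (ℕ → ℚ) → (ℕ → ℚ) → ℚ → Set
  WithinError L T e = ∀ x → 1 ≤ x → x ≤ suc M → (0ℚ ≤ℚ L x - T x) × (L x - T x ≤ℚ e)

  WithinError-mono : ∀ {L T e e′} → e ≤ℚ e′ → WithinError L T e → WithinError L T e′
  WithinError-mono e≤e′ err x 1≤x x≤1+M = proj₁ (err x 1≤x x≤1+M) , ℚP.≤-trans (proj₂ (err x 1≤x x≤1+M)) e≤e′

  -- If L′ decreases by f m · L (nx m) at each step, the truncation ∑_{lo ≤ m ≤ M} f m · T (nx m)
  -- misses L′ (M + 1) plus the accumulated inner errors, each at most e / m.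
  tail-estimate : ∀ (f : ℕ → ℚ) (nx : ℕ → ℕ) (L T L′ : ℕ → ℚ) (e C : ℚ) →
    (∀ m → 1 ≤ m → (0ℚ ≤ℚ f m) × (f m ≤ℚ inv m)) →
    (∀ m → 1 ≤ m → m ≤ M → (1 ≤ nx m) × (nx m ≤ suc M)) →
    WithinError L T e → 0ℚ ≤ℚ e →
    (∀ m → 1 ≤ m → L′ m - L′ (suc m) ≡ f m * L (nx m)) →
    (0ℚ ≤ℚ L′ (suc M)) × (L′ (suc M) ≤ℚ C) →
    WithinError L′ (λ lo → ∑[ m ∈ range lo M ] (f m * T (nx m))) (C + e * harmonic M)
  tail-estimate f nx L T L′ e C f-bounds nx-bounds err 0≤e step (0≤L′end , L′end≤C) lo 1≤lo lo≤1+M =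
    subst (λ x → (0ℚ ≤ℚ x) × (x ≤ℚ C + e * harmonic M)) (sym decomposition) (lower , upper)
    where
    D : ℕ → ℚ
    D m = f m * (L (nx m) - T (nx m))
    D-bounds : ∀ m → 1 ≤ m → m ≤ M → (0ℚ ≤ℚ D m) × (D m ≤ℚ e * inv m)
    D-bounds m 1≤m m≤M with f-bounds m 1≤m | nx-bounds m 1≤m m≤M
    ... | 0≤f , f≤inv | 1≤nx , nx≤1+M with err (nx m) 1≤nx nx≤1+M
    ...   | 0≤d , d≤e =
      *-nonNeg 0≤f 0≤d ,
      ℚP.≤-trans (*-monoˡ-≤ 0≤f d≤e) (ℚP.≤-trans (*-monoʳ-≤ 0≤e f≤inv) (ℚP.≤-reflexive (ℚP.*-comm (inv m) e)))
    ∑T = ∑[ m ∈ range lo M ] (f m * T (nx m))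
    ∑L≡ : ∑[ m ∈ range lo M ] (f m * L (nx m)) ≡ L′ lo - L′ (suc M)
    ∑L≡ = trans (∑-congᵣ lo M (λ m lo≤m _ → sym (step m (ℕP.≤-trans 1≤lo lo≤m)))) (∑-telescope L′ lo M lo≤1+M)
    decomposition : L′ lo - ∑T ≡ L′ (suc M) + ∑ (range lo M) D
    decomposition = begin
      L′ lo - ∑T                                                                  ≡⟨ solve 3 (λ a b t → a :- t := b :+ ((a :- b) :- t)) refl (L′ lo) (L′ (suc M)) ∑T ⟩
      L′ (suc M) + ((L′ lo - L′ (suc M)) - ∑T)                                    ≡⟨ cong (λ x → L′ (suc M) + (x - ∑T)) (sym ∑L≡) ⟩
      L′ (suc M) + (∑[ m ∈ range lo M ] (f m * L (nx m)) - ∑T)                    ≡⟨ cong (L′ (suc M) +_) (sym (∑-- (range lo M) _ _)) ⟩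
      L′ (suc M) + ∑[ m ∈ range lo M ] (f m * L (nx m) - f m * T (nx m))          ≡⟨ cong (L′ (suc M) +_) (∑-ext (range lo M) (λ m →
                                                                                       solve 3 (λ a b c → a :* b :- a :* c := a :* (b :- c)) refl (f m) (L (nx m)) (T (nx m)))) ⟩
      L′ (suc M) + ∑ (range lo M) D                                               ∎
      where open ≡-Reasoning
    lower : 0ℚ ≤ℚ L′ (suc M) + ∑ (range lo M) D
    lower = +-nonNeg 0≤L′end (∑-nonNegᵣ lo M (λ m lo≤m m≤M → proj₁ (D-bounds m (ℕP.≤-trans 1≤lo lo≤m) m≤M)))
    upper : L′ (suc M) + ∑ (range lo M) D ≤ℚ C + e * harmonic M
    upper = ℚP.+-mono-≤ L′end≤C ∑D≤
      where
      open ℚP.≤-Reasoning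
      ∑D≤ : ∑ (range lo M) D ≤ℚ e * harmonic M
      ∑D≤ = begin
        ∑ (range lo M) D                  ≤⟨ ∑-monoᵣ lo M (λ m lo≤m m≤M → proj₂ (D-bounds m (ℕP.≤-trans 1≤lo lo≤m) m≤M)) ⟩
        ∑[ m ∈ range lo M ] (e * inv m)   ≡⟨ ∑-*ˡ (range lo M) e inv ⟩
        e * ∑ (range lo M) inv            ≤⟨ *-monoˡ-≤ 0≤e (∑inv≤harmonic lo M 1≤lo lo≤1+M) ⟩
        e * harmonic M                    ∎

module ErrorBound (z M : ℕ) (K : ℚ) (0≤K : 0ℚ ≤ℚ K) where
  open Operators z
  open Limit z
  open PartialSums z M
  open TailEstimate M

  κ : ℚ
  κ = inv (suc M) * K

  bound : ℕ → ℚ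
  bound d = κ * (1ℚ + harmonic M) ^ d

  0≤κ : 0ℚ ≤ℚ κ
  0≤κ = *-nonNeg (0≤inv (suc M)) 0≤K

  1≤1+harmonic : 1ℚ ≤ℚ 1ℚ + harmonic M
  1≤1+harmonic = p≤p+q 1ℚ (0≤harmonic M)

  0≤bound : ∀ d → 0ℚ ≤ℚ bound d
  0≤bound d = *-nonNeg 0≤κ (0≤^ d (ℚP.≤-trans (ℚP.nonNegative⁻¹ 1ℚ) 1≤1+harmonic))

  bound-suc : ∀ d → κ + bound d * harmonic M ≤ℚ bound (suc d)
  bound-suc d = begin
    κ + bound d * harmonic M               ≤⟨ ℚP.+-monoˡ-≤ _ κ≤bound ⟩
    bound d + bound d * harmonic M         ≡⟨ solve 3 (λ k p h → k :* p :+ k :* p :* h := k :* ((con 1ℚ :+ h) :* p)) refl κ P (harmonic M) ⟩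
    bound (suc d)                          ∎
    where
    open ℚP.≤-Reasoning
    P = (1ℚ + harmonic M) ^ d
    κ≤bound : κ ≤ℚ bound d
    κ≤bound = ℚP.≤-trans (ℚP.≤-reflexive (sym (ℚP.*-identityʳ κ))) (*-monoˡ-≤ 0≤κ (1≤^ d 1≤1+harmonic))

  Φ-at-end : ∀ {c} → NonNegative c → total c ≤ℚ K → (0ℚ ≤ℚ Φ c (suc M)) × (Φ c (suc M) ≤ℚ κ)
  Φ-at-end 0≤c total≤K = 0≤Φ (suc M) 0≤c , ℚP.≤-trans (Φ≤inv*total (suc M) 0≤c (s≤s z≤n)) (*-monoˡ-≤ (0≤inv (suc M)) total≤K)

  -- The innermost sum has the constant 1 inside, approximated with error 0 ≤ bound 0.
  stepLast-error : total one ≤ℚ K → WithinError (Φ one) stepLast (bound 1)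
  stepLast-error total≤K x 1≤x x≤1+M = subst (λ t → (0ℚ ≤ℚ Φ one x - t) × (Φ one x - t ≤ℚ bound 1))
      (∑-ext (range x M) (λ m → ℚP.*-identityʳ _))
      (WithinError-mono {Φ one} {λ lo → ∑[ m ∈ range lo M ] (f m * 1ℚ)} (bound-suc 0)
        (tail-estimate f id (λ _ → 1ℚ) (λ _ → 1ℚ) (Φ one) (bound 0) κ
          (λ m 1≤m → p≤q⇒0≤q-p (inv-antimono-≤ 1≤m (ℕP.m≤m+n m z)) , 0≤p⇒q-p≤q (0≤inv (m +ₙ z)))
          (λ m 1≤m m≤M → 1≤m , ℕP.m≤n⇒m≤1+n m≤M)
          (λ _ _ _ → ℚP.≤-reflexive (sym (ℚP.+-inverseʳ 1ℚ)) , ℚP.≤-trans (ℚP.≤-reflexive (ℚP.+-inverseʳ 1ℚ)) (0≤bound 0))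
          (0≤bound 0) (λ m _ → trans (Φ-one-diff m) (sym (ℚP.*-identityʳ (f m))))
          (Φ-at-end one-nonNeg total≤K))
        x 1≤x x≤1+M)
    where
    f : ℕ → ℚ
    f m = inv m - inv (m +ₙ z)

  stepWithin-error : ∀ c T d → NonNegative c → total (⟦ yWord ⟧* c) ≤ℚ K →
                     WithinError (Φ c) T (bound d) → WithinError (Φ (⟦ yWord ⟧* c)) (stepWithin T) (bound (suc d))
  stepWithin-error c T d 0≤c total≤K err = WithinError-mono {Φ (⟦ yWord ⟧* c)} {stepWithin T} (bound-suc d)
    (tail-estimate (λ m → inv (m +ₙ z)) id (Φ c) T (Φ (⟦ yWord ⟧* c)) (bound d) κ
      (λ m 1≤m → 0≤inv (m +ₙ z) , inv-antimono-≤ 1≤m (ℕP.m≤m+n m z))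
      (λ m 1≤m m≤M → 1≤m , ℕP.m≤n⇒m≤1+n m≤M)
      err (0≤bound d) (Φ-yWord-diff c) (Φ-at-end (⟦⟧*-nonNeg yWord 0≤c) total≤K))

  stepAcross-error : ∀ c T d → NonNegative c → total (⟦ xWord ⟧* c) ≤ℚ K →
                     WithinError (Φ c) T (bound d) → WithinError (Φ (⟦ xWord ⟧* c)) (stepAcross T) (bound (suc d))
  stepAcross-error c T d 0≤c total≤K err = WithinError-mono {Φ (⟦ xWord ⟧* c)} {stepAcross T} (bound-suc d)
    (tail-estimate inv suc (Φ c) T (Φ (⟦ xWord ⟧* c)) (bound d) κ
      (λ m _ → 0≤inv m , ℚP.≤-refl)
      (λ m _ m≤M → s≤s z≤n , s≤s m≤M)
      err (0≤bound d) (Φ-xWord-diff c) (Φ-at-end (⟦⟧*-nonNeg xWord 0≤c) total≤K))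

  lastBlock-error : ∀ j → totalsLast (suc j) ≤ℚ K →
                    WithinError (Φ (⟦ yWord ^ʷ j ⟧* one)) (lastBlockSum (suc j)) (bound (suc j))
  lastBlock-error zero    totals≤K = stepLast-error (proj₁ (+≤-split (0≤total one-nonNeg) ℚP.≤-refl totals≤K))
  lastBlock-error (suc i) totals≤K with +≤-split (0≤total (⟦⟧*-nonNeg (yWord ^ʷ suc i) one-nonNeg)) (0≤totalsLast (suc i)) totals≤K
  ... | total≤K , rest≤K = stepWithin-error _ _ (suc i) (⟦⟧*-nonNeg (yWord ^ʷ i) one-nonNeg) total≤K (lastBlock-error i rest≤K)

  midBlock-error : ∀ j c T d → NonNegative c → totalsMid (suc j) c ≤ℚ K → WithinError (Φ c) T (bound d) →
                   WithinError (Φ (⟦ yWord ^ʷ j ⟧* (⟦ xWord ⟧* c))) (midBlockSum (suc j) T) (bound (suc j +ₙ d))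
  midBlock-error zero    c T d 0≤c totals≤K err =
    stepAcross-error c T d 0≤c (proj₁ (+≤-split (0≤total (⟦⟧*-nonNeg xWord 0≤c)) ℚP.≤-refl totals≤K)) err
  midBlock-error (suc i) c T d 0≤c totals≤K err
    with +≤-split (0≤total (⟦⟧*-nonNeg (yWord ^ʷ suc i) (⟦⟧*-nonNeg xWord 0≤c))) (0≤totalsMid (suc i) 0≤c) totals≤K
  ... | total≤K , rest≤K = stepWithin-error _ _ (suc i +ₙ d) (⟦⟧*-nonNeg (yWord ^ʷ i) (⟦⟧*-nonNeg xWord 0≤c)) total≤K
                             (midBlock-error i c T d 0≤c rest≤K err)

  partialSum-error : ∀ j js → All (1 ≤_) (j ∷ js) → totals j js ≤ℚ K →
                     WithinError (Φ (limitVec j js)) (partialSum (j ∷ js)) (bound (sum (j ∷ js)))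
  partialSum-error zero    _         (() ∷ _)       _
  partialSum-error (suc i) []        _              totals≤K =
    subst (WithinError (Φ (limitVec (suc i) [])) (partialSum (suc i ∷ [])) ∘ bound) (sym (ℕP.+-identityʳ (suc i))) (lastBlock-error i totals≤K)
  partialSum-error (suc i) (j′ ∷ js) (_ ∷ 1≤j′∷js) totals≤K
    with +≤-split (0≤totalsMid (suc i) (limitVec-nonNeg j′ js)) (0≤totals j′ js) totals≤K
  ... | mid≤K , rest≤K = midBlock-error i _ _ _ (limitVec-nonNeg j′ js) mid≤K (partialSum-error j′ js 1≤j′∷js rest≤K)

ConvergesTo-cong : ∀ {f g : ℕ → ℚ} {q r : ℚ} → (∀ M → f M ≡ g M) → q ≡ r → ConvergesTo g r → ConvergesTo f q
ConvergesTo-cong {q = q} f≡g refl g→r ε 0<ε with g→r ε 0<ε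
... | M₀ , close = M₀ , λ M M₀≤M → subst (λ x → ∣ x - q ∣ <ℚ ε) (sym (f≡g M)) (close M M₀≤M)

module Convergence (z j : ℕ) (js : List ℕ) (1≤j∷js : All (1 ≤_) (j ∷ js)) where
  open Operators z
  open Limit z

  K : ℚ
  K = totals j js

  0≤K : 0ℚ ≤ℚ K
  0≤K = 0≤totals j js

  d : ℕ
  d = sum (j ∷ js)

  A : ℚ
  A = K * K * fromℕ (growth (d +ₙ d))

  module _ (M : ℕ) where
    open ErrorBound z M K 0≤K
    open PartialSums z M

    ∣partialSum-Φ∣≤bound : ∣ partialSum (j ∷ js) 1 - Φ (limitVec j js) 1 ∣ ≤ℚ bound d
    ∣partialSum-Φ∣≤bound = begin
      ∣ T - L ∣          ≡⟨ cong ∣_∣ (solve 2 (λ t l → t :- l := :- (l :- t)) refl T L) ⟩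
      ∣ - (L - T) ∣      ≡⟨ trans (ℚP.∣-p∣≡∣p∣ (L - T)) (ℚP.0≤p⇒∣p∣≡p (proj₁ error)) ⟩
      L - T              ≤⟨ proj₂ error ⟩
      bound d            ∎
      where
      open ℚP.≤-Reasoning
      T = partialSum (j ∷ js) 1
      L = Φ (limitVec j js) 1
      error = partialSum-error j js 1≤j∷js ℚP.≤-refl 1 (s≤s z≤n) (s≤s z≤n)

    bound² : bound d * bound d ≤ℚ inv (suc M) * A
    bound² = begin
      (ι * K * P) * (ι * K * P)
        ≡⟨ solve 3 (λ i k p → (i :* k :* p) :* (i :* k :* p) := i :* (k :* k) :* (p :* p) :* i) refl ι K P ⟩
      ι * (K * K) * (P * P) * ι
        ≡⟨ cong (λ w → ι * (K * K) * w * ι) (sym (^-homo-* (1ℚ + harmonic M) d d)) ⟩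
      ι * (K * K) * (1ℚ + harmonic M) ^ (d +ₙ d) * ι
        ≤⟨ *-monoʳ-≤ (0≤inv (suc M)) (*-monoˡ-≤ (*-nonNeg (0≤inv (suc M)) (*-nonNeg 0≤K 0≤K)) (1+harmonic^≤ (d +ₙ d) M)) ⟩
      ι * (K * K) * (fromℕ (growth (d +ₙ d)) * fromℕ (suc M)) * ι
        ≡⟨ solve 5 (λ i k c n i′ → i :* k :* (c :* n) :* i′ := i :* (k :* c) :* (n :* i′)) refl ι (K * K) (fromℕ (growth (d +ₙ d))) (fromℕ (suc M)) ι ⟩
      ι * A * (fromℕ (suc M) * ι)
        ≡⟨ trans (cong (ι * A *_) (fromℕ*inv≡1 M)) (ℚP.*-identityʳ _) ⟩
      ι * A
        ∎
      where
      open ℚP.≤-Reasoning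
      ι = inv (suc M)
      P = (1ℚ + harmonic M) ^ d

  -- bound d ≈ K (log M)ᵈ / M; squaring it trades the logarithmic factor for one more power of M.
  bound-eventually< : ∀ ε → 0ℚ <ℚ ε → ∃ λ n → ∀ M → n ≤ M → ErrorBound.bound z M K 0≤K d <ℚ ε
  bound-eventually< ε 0<ε with archimedean A (ε * ε) (0<p⇒0<p*p 0<ε)
  ... | n , A<εε*n = n , λ M n≤M → square-<⇒< (ErrorBound.0≤bound z M K 0≤K d) 0<ε
                                     (ℚP.≤-<-trans (bound² M) (A/[1+M]<εε M n≤M))
    where
    A/[1+M]<εε : ∀ M → n ≤ M → inv (suc M) * A <ℚ ε * ε
    A/[1+M]<εε M n≤M = ℚP.<-≤-trans (ℚP.*-monoʳ-<-pos (inv (suc M)) {{ℚP.normalize-pos 1 (suc M)}} A<εε*[1+M]) (ℚP.≤-reflexive (begin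
      inv (suc M) * (ε * ε * fromℕ (suc M))   ≡⟨ solve 3 (λ i e n → i :* (e :* n) := e :* (n :* i)) refl (inv (suc M)) (ε * ε) (fromℕ (suc M)) ⟩
      ε * ε * (fromℕ (suc M) * inv (suc M))   ≡⟨ cong (ε * ε *_) (fromℕ*inv≡1 M) ⟩
      ε * ε * 1ℚ                              ≡⟨ ℚP.*-identityʳ (ε * ε) ⟩
      ε * ε                                   ∎))
      where
      open ≡-Reasoning
      A<εε*[1+M] : A <ℚ ε * ε * fromℕ (suc M)
      A<εε*[1+M] = ℚP.<-≤-trans A<εε*n (*-monoˡ-≤ (ℚP.<⇒≤ (0<p⇒0<p*p 0<ε)) (fromℕ-mono-≤ (ℕP.m≤n⇒m≤1+n n≤M)))

  partialSum-converges : ConvergesTo (λ M → PartialSums.partialSum z M (j ∷ js) 1) (Φ (limitVec j js) 1)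
  partialSum-converges ε 0<ε = proj₁ eventually , close
    where
    eventually = bound-eventually< ε 0<ε
    close : ∀ M → proj₁ eventually ≤ M → ∣ PartialSums.partialSum z M (j ∷ js) 1 - Φ (limitVec j js) 1 ∣ <ℚ ε
    close M n≤M = ℚP.≤-<-trans (∣partialSum-Φ∣≤bound M) (proj₂ eventually M n≤M)

proposition5p2 : (k : List ℕ) → k ≢ [] → All (λ x → 1 ≤ x) k →
    (N : ℕ) → 1 ≤ N →
    ConvergesTo (Gpartial (N ∸ 1) (reverse k)) (zetaStarFlat< N k)
proposition5p2 []       k≢[] _      _       _  = ⊥-elim (k≢[] refl)
proposition5p2 (k ∷ ks) _    _      zero    ()
proposition5p2 (k ∷ ks) _    1≤k∷ks (suc z) _  with reverse-∷ k ks
... | y , ys , rev≡ = ConvergesTo-cong Gpartial≡partialSum (ZetaIdentity.zetaStarFlat<≡Φ z k ks y ys 1≤k∷ks rev≡)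
                                       (Convergence.partialSum-converges z y ys 1≤y∷ys)
  where
  1≤y∷ys : All (1 ≤_) (y ∷ ys)
  1≤y∷ys = subst (All (1 ≤_)) rev≡ (All-reverse (k ∷ ks) 1≤k∷ks)
  Gpartial≡partialSum : ∀ M → Gpartial z (reverse (k ∷ ks)) M ≡ PartialSums.partialSum z M (y ∷ ys) 1
  Gpartial≡partialSum M = trans (cong (λ l → Gpartial z l M) rev≡) (PartialSums.∑gTerm≡partialSum z M (y ∷ ys) 1≤y∷ys 1)
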